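{- Let $\Gamma$ be a weighted digraph with forest dimension $v$ and let $K$ be an undominated knot of $\Gamma$. Let $Q_{n-v}=(q^{n-v}_{ij})$ be its matrix of maximum out forests. Then: 1. For every $i\in V(\Gamma)$, $\sum_{j=1}^n q^{n-v}_{ij}=\varepsilon(\mathcal F_{n-v})$. 2. $q^{n-v}_{ij}\neq0$ if and only if $j\in\tilde K$ and $i$ is reachable from $j$ in $\Gamma$. 3. If $j\in K$, then for every $i\in V(\Gamma)$, $q^{n-v}_{ij}=\varepsilon(\mathcal T^j)\,\varepsilon(\mathcal P^{K\to i})$; moreover, if $i\in K^+$, then $q^{n-v}_{ij}=q^{n-v}_{jj}=\varepsilon(\mathcal T^j)\,\varepsilon(\mathcal P)$. 4. $\sum_{j\in K}q^{n-v}_{jj}=\varepsilon(\mathcal F_{n-v})$; in particular, if $j$ is an undominated vertex then $q^{n-v}_{jj}=\varepsilon(\mathcal F_{n-v})$. 5. If $j_1,j_2\in K$, then the $j_2$-th column of $Q_{n-v}$ equals $\bigl(\varepsilon(\mathcal T^{j_2})/\varepsilon(\mathcal T^{j_1})\bigr)$ times its $j_1$-th column.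
   Context: $\Gamma$: loopless digraph on $V(\Gamma)=\{1,\dots,n\}$, $n>1$, arc weights $\varepsilon_{ij}>0$. Weight of a subgraph = product of its arc weights (1 if no arcs); weight of a set of subgraphs = sum of weights (0 if empty). A vertex $w$ is reachable from $z$ if $w=z$ or there is a directed path from $z$ to $w$. A vertex is undominated if its indegree is 0, dominated otherwise. A diverging forest is a digraph without circuits with all indegrees $\le1$; its roots are the indegree-0 vertices; each weak component is a tree diverging from a root. A maximum out forest of $\Gamma$ is a spanning diverging forest of $\Gamma$ with the maximum number of arcs; the forest dimension $v$ is its number of roots. $\mathcal F_k$: spanning diverging forests of $\Gamma$ with $k$ arcs; $\mathcal F_k^{j\to i}$: those in which $i$ lies in the tree rooted at $j$. $Q_{n-v}=(q^{n-v}_{ij})$, $q^{n-v}_{ij}=\varepsilon(\mathcal F^{j\to i}_{n-v})$. An undominated knot is a nonempty $K\subseteq V(\Gamma)$ whose vertices are mutually reachable and such that there is no arc from a vertex outside $K$ to a vertex of $K$. $\tilde K$ is the union of all undominated knots; $K^+$ is the set of vertices reachable from $K$ and unreachable from every other undominated knot. $\Gamma_K$ is the restriction (induced subgraph) of $\Gamma$ to $K$, and $\Gamma_{ -K}$ is the spanning subgraph with arc set $E(\Gamma)\setminus E(\Gamma_K)$. $\mathcal T$ is the set of spanning diverging trees of $\Gamma_K$, $\mathcal T^j$ those diverging from $j\in K$; $\mathcal P$ is the set of maximum out forests of $\Gamma_{ -K}$, and $\mathcal P^{K\to i}$ those in which $i$ is reachable from some vertex of $K$.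
   Formalization: The arc weights $\varepsilon_{ij}$ take values in the positive rationals. -}

module Defs where

open import Data.Nat as ℕ using (ℕ; zero; suc; _≤_; _∸_)
open import Data.Fin using (Fin; toℕ)
open import Data.Fin.Properties using (all?; any?)
open import Data.Fin.Subset using (Subset; _∈_; _∉_)
open import Data.Fin.Subset.Properties using (_∈?_)
open import Data.Bool using (Bool; true; false; _∧_; not; if_then_else_)
open import Data.Maybe using (Maybe; just; nothing; _>>=_; maybe; is-just)
import Data.Maybe.Properties as MaybeP
import Data.Fin.Properties as FinP
open import Data.Vec using (Vec; []; _∷_; lookup)
open import Data.List as List using (List; []; _∷_; concatMap; map; foldr)
open import Data.Product using (Σ; _×_; _,_; ∃; ∃-syntax)
open import Data.Rational using (ℚ; 0ℚ; 1ℚ; _+_; _*_; _<_)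
open import Relation.Binary.PropositionalEquality using (_≡_; _≢_)
open import Relation.Nullary using (Dec; does; ¬_; ¬?)
open import Relation.Nullary.Decidable using (_×-dec_; _→-dec_)
import Data.Bool.Properties as BoolP
import Data.Nat.Properties as NatP

-- Weighted digraphs on the vertex set Fin n  (vertex i of the paper is
-- the element of Fin n with toℕ = i - 1).

record Digraph (n : ℕ) : Set where
  field
    arc : Fin n → Fin n → Bool
    wt  : Fin n → Fin n → ℚ      -- ε_{uv} (only meaningful on arcs)
open Digraph public

WeightedDigraph : ∀ {n} → Digraph n → Set
WeightedDigraph {n} Γ =
  (∀ (v : Fin n) → arc Γ v v ≡ false) ×
  (∀ (u v : Fin n) → arc Γ u v ≡ true → 0ℚ < wt Γ u v)

data Reach {n} (Γ : Digraph n) (z : Fin n) : Fin n → Set where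
  here : Reach Γ z z
  step : ∀ {u w} → Reach Γ z u → arc Γ u w ≡ true → Reach Γ z w

Undominated : ∀ {n} → Digraph n → Fin n → Set
Undominated {n} Γ j = ∀ (u : Fin n) → arc Γ u j ≡ false

-- Spanning subgraphs with all indegrees ≤ 1 are encoded by a "parent"
-- function  f : Fin n → Maybe (Fin n) :  f v ≡ just u  means that the
-- (unique) arc entering v is u → v;  f v ≡ nothing means indegree 0.

Par : ℕ → Set
Par n = Fin n → Maybe (Fin n)

anc : ∀ {n} → Par n → ℕ → Fin n → Maybe (Fin n)
anc f zero    v = just v
anc f (suc k) v = anc f k v >>= f

ArcsIn : ∀ {n} → (Fin n → Fin n → Bool) → Par n → Set
ArcsIn {n} A f = ∀ (v u : Fin n) → f v ≡ just u → A u v ≡ true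

-- no circuits (a circuit has length between 1 and n)
NoCircuit : ∀ {n} → Par n → Set
NoCircuit {n} f = ∀ (v : Fin n) (k : Fin n) → anc f (suc (toℕ k)) v ≢ just v

IsDivForest : ∀ {n} → (Fin n → Fin n → Bool) → Par n → Set
IsDivForest A f = ArcsIn A f × NoCircuit f

countFin : ∀ {n} → (Fin n → Bool) → ℕ
countFin {n} p = List.length (List.filterᵇ p (List.allFin n))

arcCount : ∀ {n} → Par n → ℕ
arcCount f = countFin (λ v → is-just (f v))

rootCount : ∀ {n} → Par n → ℕ
rootCount f = countFin (λ v → not (is-just (f v)))

ForestReach : ∀ {n} → Par n → Fin n → Fin n → Set
ForestReach {n} f z i = ∃[ k ] anc f (toℕ {n} k) i ≡ just z

InTree : ∀ {n} → Par n → Fin n → Fin n → Set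
InTree f j i = (f j ≡ nothing) × ForestReach f j i

IsMaxOutForest : ∀ {n} → (Fin n → Fin n → Bool) → Par n → Set
IsMaxOutForest {n} A f =
  IsDivForest A f × (∀ (g : Par n) → IsDivForest A g → arcCount g ≤ arcCount f)

MaxForestArcs : ∀ {n} → (Fin n → Fin n → Bool) → ℕ → Set
MaxForestArcs A m = ∃[ f ] (IsMaxOutForest A f × arcCount f ≡ m)

ForestDim : ∀ {n} → Digraph n → ℕ → Set
ForestDim Γ v = ∃[ f ] (IsMaxOutForest (arc Γ) f × rootCount f ≡ v)

anc≟ : ∀ {n} (f : Par n) k v (x : Maybe (Fin n)) → Dec (anc f k v ≡ x)
anc≟ f k v x = MaybeP.≡-dec FinP._≟_ (anc f k v) x

arcsIn? : ∀ {n} A (f : Par n) → Dec (ArcsIn A f)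
arcsIn? A f = all? λ v → all? λ u →
  MaybeP.≡-dec FinP._≟_ (f v) (just u) →-dec (A u v BoolP.≟ true)

noCircuit? : ∀ {n} (f : Par n) → Dec (NoCircuit f)
noCircuit? f = all? λ v → all? λ k → ¬? (anc≟ f (suc (toℕ k)) v (just v))

isDivForest? : ∀ {n} A (f : Par n) → Dec (IsDivForest A f)
isDivForest? A f = arcsIn? A f ×-dec noCircuit? f

forestReach? : ∀ {n} (f : Par n) z i → Dec (ForestReach f z i)
forestReach? f z i = any? λ k → anc≟ f (toℕ k) i (just z)

inTree? : ∀ {n} (f : Par n) j i → Dec (InTree f j i)
inTree? f j i = MaybeP.≡-dec FinP._≟_ (f j) nothing ×-dec forestReach? f j i

allVec : ∀ {A : Set} → List A → (k : ℕ) → List (Vec A k)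
allVec xs zero    = [] ∷ []
allVec xs (suc k) = concatMap (λ x → map (x ∷_) (allVec xs k)) xs

allMaybeFin : (n : ℕ) → List (Maybe (Fin n))
allMaybeFin n = nothing ∷ map just (List.allFin n)

allPar : (n : ℕ) → List (Par n)
allPar n = map lookup (allVec (allMaybeFin n) n)

sumFin : ∀ {n} → (Fin n → ℚ) → ℚ
sumFin {n} g = foldr (λ j s → g j + s) 0ℚ (List.allFin n)

prodFin : ∀ {n} → (Fin n → ℚ) → ℚ
prodFin {n} g = foldr (λ j s → g j * s) 1ℚ (List.allFin n)

wF : ∀ {n} → Digraph n → Par n → ℚ
wF Γ f = prodFin (λ v → maybe (λ u → wt Γ u v) 1ℚ (f v))

wSet : ∀ {n} → Digraph n → (P : Par n → Set) → (∀ f → Dec (P f)) → ℚ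
wSet {n} Γ P P? =
  foldr (λ f s → (if does (P? f) then wF Γ f else 0ℚ) + s) 0ℚ (allPar n)

epsF : ∀ {n} → Digraph n → ℕ → ℚ
epsF Γ k = wSet Γ (λ f → IsDivForest (arc Γ) f × arcCount f ≡ k)
  (λ f → isDivForest? (arc Γ) f ×-dec (arcCount f NatP.≟ k))

qEntry : ∀ {n} → Digraph n → ℕ → Fin n → Fin n → ℚ
qEntry Γ k i j =
  wSet Γ (λ f → (IsDivForest (arc Γ) f × arcCount f ≡ k) × InTree f j i)
    (λ f → (isDivForest? (arc Γ) f ×-dec (arcCount f NatP.≟ k)) ×-dec inTree? f j i)

UndomKnot : ∀ {n} → Digraph n → Subset n → Set
UndomKnot {n} Γ K =
  (∃[ k ] k ∈ K) ×
  (∀ (a b : Fin n) → a ∈ K → b ∈ K → Reach Γ a b) ×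
  (∀ (u w : Fin n) → u ∉ K → w ∈ K → arc Γ u w ≡ false)

InKtilde : ∀ {n} → Digraph n → Fin n → Set
InKtilde Γ j = ∃[ K ] (UndomKnot Γ K × j ∈ K)

InKplus : ∀ {n} → Digraph n → Subset n → Fin n → Set
InKplus {n} Γ K i =
  (∃[ k ] (k ∈ K × Reach Γ k i)) ×
  (∀ (K' : Subset n) → UndomKnot Γ K' → K' ≢ K →
     ∀ (k' : Fin n) → k' ∈ K' → ¬ Reach Γ k' i)

inK : ∀ {n} → Subset n → Fin n → Bool
inK K v = does (v ∈? K)

-- arcs of Γ_K (induced subgraph on K, kept on vertex set Fin n)
arcK : ∀ {n} → Digraph n → Subset n → Fin n → Fin n → Bool
arcK Γ K u v = arc Γ u v ∧ inK K u ∧ inK K v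

arcMinusK : ∀ {n} → Digraph n → Subset n → Fin n → Fin n → Bool
arcMinusK Γ K u v = arc Γ u v ∧ not (inK K u ∧ inK K v)

-- 𝓣^j : spanning diverging trees of Γ_K diverging from j, encoded as
-- diverging forests f using only arcs of Γ_K (so every vertex outside K
-- is an isolated root) in which every vertex of K lies in the tree of j
IsTreeFrom : ∀ {n} → Digraph n → Subset n → Fin n → Par n → Set
IsTreeFrom {n} Γ K j f =
  IsDivForest (arcK Γ K) f × (∀ (i : Fin n) → i ∈ K → InTree f j i)

isTreeFrom? : ∀ {n} Γ K j (f : Par n) → Dec (IsTreeFrom Γ K j f)
isTreeFrom? Γ K j f = isDivForest? (arcK Γ K) f ×-dec
  (all? λ i → (i ∈? K) →-dec inTree? f j i)

epsT : ∀ {n} → Digraph n → Subset n → Fin n → ℚ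
epsT Γ K j = wSet Γ (IsTreeFrom Γ K j) (isTreeFrom? Γ K j)

-- 𝓟 : maximum out forests of Γ_{-K}, given that m is their number of arcs
epsP : ∀ {n} → Digraph n → Subset n → ℕ → ℚ
epsP Γ K m = wSet Γ (λ f → IsDivForest (arcMinusK Γ K) f × arcCount f ≡ m)
  (λ f → isDivForest? (arcMinusK Γ K) f ×-dec (arcCount f NatP.≟ m))

epsPto : ∀ {n} → Digraph n → Subset n → ℕ → Fin n → ℚ
epsPto Γ K m i =
  wSet Γ (λ f → (IsDivForest (arcMinusK Γ K) f × arcCount f ≡ m) ×
                 (∃[ z ] (z ∈ K × ForestReach f z i)))
    (λ f → (isDivForest? (arcMinusK Γ K) f ×-dec (arcCount f NatP.≟ m)) ×-dec
           any? (λ z → (z ∈? K) ×-dec forestReach? f z i))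

-- A root r′ of a maximum out forest that reaches another root r could adopt r's
-- tree, giving more arcs; hence every undominated knot contains exactly one root,
-- every root lies in an undominated knot, and each vertex lies in exactly one tree
-- (parts 1 and 4).  For j in an undominated knot K, a maximum forest in which i
-- hangs below j is the same thing as a spanning tree of Γ_K diverging from j glued
-- to a maximum forest of Γ_{-K} in which i is reached from K: nothing enters K in
-- Γ_{-K}, and the arc counts add up to exactly n - v.  Summing the multiplicative
-- weights over this bijection gives the product formula of part 3, whence part 5
-- because ε(𝒯^j) > 0.  For part 2, a maximum forest in which i hangs below j is
-- built greedily: grow a tree from j, then let the remaining roots grow the rest.

module Submission where

open import Defs
open import Data.Nat as ℕ using (ℕ; zero; suc; _≤_; _<_; _∸_; z≤n; s≤s)
import Data.Nat.Properties as ℕP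
open import Data.Fin using (Fin; toℕ; fromℕ<)
import Data.Fin.Properties as FinP
open import Data.Fin.Subset using (Subset; _∈_; _∉_)
open import Data.Fin.Subset.Properties using (_∈?_)
open import Data.Bool using (Bool; true; false; _∧_; _∨_; not; if_then_else_)
import Data.Bool.Properties as BoolP
open import Data.Maybe using (Maybe; just; nothing; _>>=_; maybe; is-just)
import Data.Maybe.Properties as MaybeP
open import Data.Vec using (Vec; []; _∷_; lookup; tabulate)
import Data.Vec.Properties as VecP
open import Data.List as List using (List; []; _∷_; _++_; map; concatMap)
import Data.List.Properties as ListP
open import Data.Product using (Σ; _×_; _,_; ∃; ∃-syntax; proj₁; proj₂)
open import Data.Sum using (_⊎_; inj₁; inj₂)
open import Data.Rational as ℚ using (ℚ; 0ℚ; 1ℚ; _+_; _*_; _÷_; NonZero)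
import Data.Rational.Properties as ℚP
open import Algebra.Bundles using (CommutativeMonoid)
import Algebra.Properties.CommutativeSemigroup as CommSemigroupProperties
open import Function using (_∘_; mk⇔; Equivalence)
open import Function.Bundles using (_⇔_)
open import Function.Properties.Equivalence using () renaming (sym to ⇔-sym)
open import Relation.Binary using (DecidableEquality; _Respects_; _Preserves_⟶_; tri<; tri≈; tri>)
open import Relation.Binary.PropositionalEquality
  using (_≡_; _≢_; _≗_; refl; sym; trans; cong; cong₂; subst; module ≡-Reasoning)
open import Relation.Nullary using (Dec; yes; no; does; ¬_; contradiction; _×-dec_)
open import Relation.Nullary.Decidable using (dec-true; dec-false)

-- Finite sums

ind : Bool → ℚ → ℚ
ind b q = if b then q else 0ℚ

ind-∧ : ∀ a b q → ind (a ∧ b) q ≡ ind a (ind b q)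
ind-∧ true  b q = refl
ind-∧ false b q = refl

ind-cong : ∀ b {x y} → (b ≡ true → x ≡ y) → ind b x ≡ ind b y
ind-cong true  x≡y = x≡y refl
ind-cong false _   = refl

ind-ind-∧ : ∀ a b c q → ind a (ind (b ∧ c) q) ≡ ind (b ∧ (a ∧ c)) q
ind-ind-∧ false false c q = refl
ind-ind-∧ false true  c q = refl
ind-ind-∧ true  b     c q = refl

ind-0 : ∀ b → ind b 0ℚ ≡ 0ℚ
ind-0 true  = refl
ind-0 false = refl

ind-ind-0 : ∀ a b → ind a (ind b 0ℚ) ≡ 0ℚ
ind-ind-0 a b = trans (cong (ind a) (ind-0 b)) (ind-0 a)

ind-≤ : ∀ b {q} → 0ℚ ℚ.≤ q → ind b q ℚ.≤ q
ind-≤ true  _   = ℚP.≤-refl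
ind-≤ false 0≤q = 0≤q

0≤ind : ∀ b {q} → (b ≡ true → 0ℚ ℚ.≤ q) → 0ℚ ℚ.≤ ind b q
0≤ind true  0≤q = 0≤q refl
0≤ind false _   = ℚP.≤-refl

dec-true⁻¹ : ∀ {A : Set} (a? : Dec A) → does a? ≡ true → A
dec-true⁻¹ (yes a) _ = a

bool-≡ : ∀ {a b} → (a ≡ true → b ≡ true) → (b ≡ true → a ≡ true) → a ≡ b
bool-≡ {true}  a⇒b b⇒a = sym (a⇒b refl)
bool-≡ {false} {true}  a⇒b b⇒a = b⇒a refl
bool-≡ {false} {false} a⇒b b⇒a = refl

does-≡ : ∀ {A B : Set} (a? : Dec A) (b? : Dec B) → A ⇔ B → does a? ≡ does b?
does-≡ (yes a) b? A⇔B = sym (dec-true b? (Equivalence.to A⇔B a))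
does-≡ (no ¬a) b? A⇔B = sym (dec-false b? (¬a ∘ Equivalence.from A⇔B))

*-÷-cancel : ∀ a b c .{{_ : NonZero b}} → a * c ≡ (a ÷ b) * (b * c)
*-÷-cancel a b c = sym (begin
  (a * b⁻¹) * (b * c)  ≡⟨ ℚP.*-assoc a b⁻¹ (b * c) ⟩
  a * (b⁻¹ * (b * c))  ≡⟨ cong (a *_) (sym (ℚP.*-assoc b⁻¹ b c)) ⟩
  a * ((b⁻¹ * b) * c)  ≡⟨ cong (λ x → a * (x * c)) (ℚP.*-inverseˡ b) ⟩
  a * (1ℚ * c)         ≡⟨ cong (a *_) (ℚP.*-identityˡ c) ⟩
  a * c                ∎)
  where
  open ≡-Reasoning
  b⁻¹ = ℚ.1/ b

module _ {A : Set} where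

  sumL : List A → (A → ℚ) → ℚ
  sumL xs g = List.foldr (λ x s → g x + s) 0ℚ xs

  syntax sumL xs (λ x → e) = ∑[ x ← xs ] e

  sumL-cong : ∀ xs {g h : A → ℚ} → g ≗ h → sumL xs g ≡ sumL xs h
  sumL-cong []       g≗h = refl
  sumL-cong (x ∷ xs) g≗h = cong₂ _+_ (g≗h x) (sumL-cong xs g≗h)

  sumL-0 : ∀ xs {g : A → ℚ} → (∀ x → g x ≡ 0ℚ) → sumL xs g ≡ 0ℚ
  sumL-0 []       g≡0 = refl
  sumL-0 (x ∷ xs) g≡0 = trans (cong₂ _+_ (g≡0 x) (sumL-0 xs g≡0)) (ℚP.+-identityˡ 0ℚ)

  sumL-++ : ∀ xs ys (g : A → ℚ) → sumL (xs ++ ys) g ≡ sumL xs g + sumL ys g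
  sumL-++ []       ys g = sym (ℚP.+-identityˡ _)
  sumL-++ (x ∷ xs) ys g = trans (cong (g x +_) (sumL-++ xs ys g)) (sym (ℚP.+-assoc (g x) _ _))

  sumL-+ : ∀ xs (g h : A → ℚ) → ∑[ x ← xs ] (g x + h x) ≡ sumL xs g + sumL xs h
  sumL-+ []       g h = sym (ℚP.+-identityˡ 0ℚ)
  sumL-+ (x ∷ xs) g h = trans (cong (g x + h x +_) (sumL-+ xs g h))
    (interchange (g x) (h x) (sumL xs g) (sumL xs h))
    where open CommSemigroupProperties (CommutativeMonoid.commutativeSemigroup ℚP.+-0-commutativeMonoid)

  sumL-*ˡ : ∀ xs c (g : A → ℚ) → c * sumL xs g ≡ ∑[ x ← xs ] (c * g x)
  sumL-*ˡ []       c g = ℚP.*-zeroʳ c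
  sumL-*ˡ (x ∷ xs) c g = trans (ℚP.*-distribˡ-+ c (g x) _) (cong (c * g x +_) (sumL-*ˡ xs c g))

  sumL-*ʳ : ∀ xs c (g : A → ℚ) → sumL xs g * c ≡ ∑[ x ← xs ] (g x * c)
  sumL-*ʳ xs c g =
    trans (ℚP.*-comm _ c) (trans (sumL-*ˡ xs c g) (sumL-cong xs λ x → ℚP.*-comm c (g x)))

  ind-sumL : ∀ xs b (g : A → ℚ) → ind b (sumL xs g) ≡ ∑[ x ← xs ] ind b (g x)
  ind-sumL xs true  g = refl
  ind-sumL xs false g = sym (sumL-0 xs λ _ → refl)

  sumL-mono-≤ : ∀ xs {g h : A → ℚ} → (∀ x → g x ℚ.≤ h x) → sumL xs g ℚ.≤ sumL xs h
  sumL-mono-≤ []       g≤h = ℚP.≤-refl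
  sumL-mono-≤ (x ∷ xs) g≤h = ℚP.+-mono-≤ (g≤h x) (sumL-mono-≤ xs g≤h)

  sumL-witness : ∀ {P : A → Set} (P? : ∀ x → Dec (P x)) (g : A → ℚ) xs →
    ∑[ x ← xs ] ind (does (P? x)) (g x) ≢ 0ℚ → ∃ P
  sumL-witness P? g []       ≢0 = contradiction refl ≢0
  sumL-witness P? g (x ∷ xs) ≢0 with P? x
  ... | yes p = x , p
  ... | no  _ = sumL-witness P? g xs (≢0 ∘ trans (ℚP.+-identityˡ _))

module _ {A : Set} where

  prodL : List A → (A → ℚ) → ℚ
  prodL xs g = List.foldr (λ x s → g x * s) 1ℚ xs

  prodL-cong : ∀ xs {g h : A → ℚ} → g ≗ h → prodL xs g ≡ prodL xs h
  prodL-cong []       g≗h = refl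
  prodL-cong (x ∷ xs) g≗h = cong₂ _*_ (g≗h x) (prodL-cong xs g≗h)

  prodL-* : ∀ xs (g h : A → ℚ) → prodL xs (λ x → g x * h x) ≡ prodL xs g * prodL xs h
  prodL-* []       g h = sym (ℚP.*-identityˡ 1ℚ)
  prodL-* (x ∷ xs) g h = trans (cong (g x * h x *_) (prodL-* xs g h))
    (interchange (g x) (h x) (prodL xs g) (prodL xs h))
    where open CommSemigroupProperties (CommutativeMonoid.commutativeSemigroup ℚP.*-1-commutativeMonoid)

  prodL-pos : ∀ xs {g : A → ℚ} → (∀ x → 0ℚ ℚ.< g x) → 0ℚ ℚ.< prodL xs g
  prodL-pos []       g>0 = ℚP.positive⁻¹ 1ℚ
  prodL-pos (x ∷ xs) {g} g>0 = ℚP.positive⁻¹ _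
    {{ℚP.pos*pos⇒pos (g x) {{ℚ.positive (g>0 x)}} (prodL xs g) {{ℚ.positive (prodL-pos xs g>0)}}}}

sumL-map : ∀ {A B : Set} (φ : A → B) xs (g : B → ℚ) → sumL (map φ xs) g ≡ sumL xs (g ∘ φ)
sumL-map φ []       g = refl
sumL-map φ (x ∷ xs) g = cong (g (φ x) +_) (sumL-map φ xs g)

sumL-concatMap : ∀ {A B : Set} (φ : A → List B) xs (g : B → ℚ) →
  sumL (concatMap φ xs) g ≡ ∑[ x ← xs ] sumL (φ x) g
sumL-concatMap φ []       g = refl
sumL-concatMap φ (x ∷ xs) g =
  trans (sumL-++ (φ x) (concatMap φ xs) g) (cong (sumL (φ x) g +_) (sumL-concatMap φ xs g))

sumL-swap : ∀ {A B : Set} xs ys (F : A → B → ℚ) →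
  ∑[ x ← xs ] sumL ys (F x) ≡ ∑[ y ← ys ] ∑[ x ← xs ] F x y
sumL-swap []       ys F = sym (sumL-0 ys λ _ → refl)
sumL-swap (x ∷ xs) ys F =
  trans (cong (sumL ys (F x) +_) (sumL-swap xs ys F)) (sym (sumL-+ ys (F x) _))

sumL-allFin-suc : ∀ n (g : Fin (suc n) → ℚ) →
  sumL (List.allFin (suc n)) g ≡ g Fin.zero + sumL (List.allFin n) (g ∘ Fin.suc)
sumL-allFin-suc n g = cong (g Fin.zero +_) (begin
  sumL (List.tabulate Fin.suc) g              ≡⟨ cong (λ xs → sumL xs g) (sym (ListP.map-tabulate (λ i → i) Fin.suc)) ⟩
  sumL (map Fin.suc (List.allFin n)) g        ≡⟨ sumL-map Fin.suc (List.allFin n) g ⟩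
  sumL (List.allFin n) (g ∘ Fin.suc)          ∎)
  where open ≡-Reasoning

sumL-product : ∀ {A B : Set} xs ys (a : A → ℚ) (b : B → ℚ) →
  ∑[ x ← xs ] ∑[ y ← ys ] (a x * b y) ≡ sumL xs a * sumL ys b
sumL-product xs ys a b = begin
  ∑[ x ← xs ] ∑[ y ← ys ] (a x * b y)  ≡⟨ sumL-cong xs (λ x → sym (sumL-*ˡ ys (a x) b)) ⟩
  ∑[ x ← xs ] (a x * sumL ys b)        ≡⟨ sym (sumL-*ʳ xs (sumL ys b) a) ⟩
  sumL xs a * sumL ys b                ∎
  where open ≡-Reasoning

module _ {A : Set} (_≟_ : DecidableEquality A) where

  -- xs lists every element of A exactly once.
  Enumerates : List A → Set
  Enumerates xs = ∀ a (g : A → ℚ) → ∑[ x ← xs ] ind (does (x ≟ a)) (g x) ≡ g a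

  sumL-single : ∀ {xs} → Enumerates xs → ∀ (b : A → Bool) a g →
    (∀ x → b x ≡ true → x ≡ a) → b a ≡ true → ∑[ x ← xs ] ind (b x) (g x) ≡ g a
  sumL-single {xs} enum b a g unique ba = trans (sumL-cong xs b≡) (enum a g)
    where
    b≡ : ∀ x → ind (b x) (g x) ≡ ind (does (x ≟ a)) (g x)
    b≡ x = cong (λ c → ind c (g x)) (bool-≡ (dec-true (x ≟ a) ∘ unique x)
             (λ x≟a → subst (λ y → b y ≡ true) (sym (dec-true⁻¹ (x ≟ a) x≟a)) ba))

module _ {A : Set} (_≟_ : DecidableEquality A) where

  just-enumerates : ∀ {xs} → Enumerates _≟_ xs →
    Enumerates (MaybeP.≡-dec _≟_) (nothing ∷ map just xs)
  just-enumerates {xs} enum nothing g = begin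
    g nothing + sumL (map just xs) h  ≡⟨ cong (g nothing +_) (trans (sumL-map just xs h) (sumL-0 xs λ _ → refl)) ⟩
    g nothing + 0ℚ                    ≡⟨ ℚP.+-identityʳ _ ⟩
    g nothing                         ∎
    where
    open ≡-Reasoning
    h : Maybe A → ℚ
    h y = ind (does (MaybeP.≡-dec _≟_ y nothing)) (g y)
  just-enumerates {xs} enum (just a) g =
    trans (ℚP.+-identityˡ _)
      (trans (sumL-map just xs (λ y → ind (does (MaybeP.≡-dec _≟_ y (just a))) (g y))) (enum a (g ∘ just)))

  allVec-enumerates : ∀ {xs} → Enumerates _≟_ xs → ∀ k → Enumerates (VecP.≡-dec _≟_) (allVec xs k)
  allVec-enumerates enum zero    []       g = ℚP.+-identityʳ _
  allVec-enumerates {xs} enum (suc k) (a ∷ u) g = begin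
    sumL (concatMap (λ x → map (x ∷_) (allVec xs k)) xs) h
      ≡⟨ sumL-concatMap (λ x → map (x ∷_) (allVec xs k)) xs h ⟩
    ∑[ x ← xs ] sumL (map (x ∷_) (allVec xs k)) h
      ≡⟨ sumL-cong xs (λ x → sumL-map (x ∷_) (allVec xs k) h) ⟩
    ∑[ x ← xs ] ∑[ w ← allVec xs k ] ind (does (x ≟ a) ∧ does (VecP.≡-dec _≟_ w u)) (g (x ∷ w))
      ≡⟨ sumL-cong xs (λ x → trans (sumL-cong (allVec xs k) λ w → ind-∧ (does (x ≟ a)) _ _)
                                   (sym (ind-sumL (allVec xs k) (does (x ≟ a)) _))) ⟩
    ∑[ x ← xs ] ind (does (x ≟ a)) (∑[ w ← allVec xs k ] ind (does (VecP.≡-dec _≟_ w u)) (g (x ∷ w)))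
      ≡⟨ sumL-cong xs (λ x → cong (ind (does (x ≟ a))) (allVec-enumerates enum k u (g ∘ (x ∷_)))) ⟩
    ∑[ x ← xs ] ind (does (x ≟ a)) (g (x ∷ u))
      ≡⟨ enum a (λ x → g (x ∷ u)) ⟩
    g (a ∷ u) ∎
    where
    open ≡-Reasoning
    h : Vec A (suc k) → ℚ
    h w = ind (does (VecP.≡-dec _≟_ w (a ∷ u))) (g w)

allFin-enumerates : ∀ n → Enumerates FinP._≟_ (List.allFin n)
allFin-enumerates (suc n) Fin.zero g = begin
  sumL (List.allFin (suc n)) h  ≡⟨ sumL-allFin-suc n h ⟩
  g Fin.zero + _                ≡⟨ cong (g Fin.zero +_) (sumL-0 (List.allFin n) λ _ → refl) ⟩
  g Fin.zero + 0ℚ               ≡⟨ ℚP.+-identityʳ _ ⟩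
  g Fin.zero                    ∎
  where
  open ≡-Reasoning
  h : Fin (suc n) → ℚ
  h x = ind (does (x FinP.≟ Fin.zero)) (g x)
allFin-enumerates (suc n) (Fin.suc a) g =
  trans (sumL-allFin-suc n (λ x → ind (does (x FinP.≟ Fin.suc a)) (g x)))
    (trans (ℚP.+-identityˡ _) (allFin-enumerates n a (g ∘ Fin.suc)))

module _ {n : ℕ} where

  -- Without function extensionality, allPar n enumerates Par n only up to ≗.
  _≗?_ : (f g : Par n) → Dec (f ≗ g)
  f ≗? g = FinP.all? λ x → MaybeP.≡-dec FinP._≟_ (f x) (g x)

  lookup≗⇔≡tabulate : ∀ (v : Vec (Maybe (Fin n)) n) (g : Par n) → lookup v ≗ g ⇔ v ≡ tabulate g
  lookup≗⇔≡tabulate v g = mk⇔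
    (λ v≗g → trans (sym (VecP.tabulate∘lookup v)) (VecP.tabulate-cong v≗g))
    (λ v≡ → subst (λ w → lookup w ≗ g) (sym v≡) (VecP.lookup∘tabulate g))

  allPar-enumerates : ∀ g (H : Par n → ℚ) → H Preserves _≗_ ⟶ _≡_ →
    ∑[ f ← allPar n ] ind (does (f ≗? g)) (H f) ≡ H g
  allPar-enumerates g H H-resp = begin
    ∑[ f ← allPar n ] ind (does (f ≗? g)) (H f)
      ≡⟨ sumL-map lookup (allVec (allMaybeFin n) n) (λ f → ind (does (f ≗? g)) (H f)) ⟩
    ∑[ v ← allVec (allMaybeFin n) n ] ind (does (lookup v ≗? g)) (H (lookup v))
      ≡⟨ sumL-cong (allVec (allMaybeFin n) n) (λ v → cong (λ c → ind c (H (lookup v)))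
           (does-≡ (lookup v ≗? g) (VecP.≡-dec _ v (tabulate g)) (lookup≗⇔≡tabulate v g))) ⟩
    ∑[ v ← allVec (allMaybeFin n) n ] ind (does (VecP.≡-dec _ v (tabulate g))) (H (lookup v))
      ≡⟨ allVec-enumerates (MaybeP.≡-dec FinP._≟_) (just-enumerates FinP._≟_ {List.allFin n} (allFin-enumerates n))
           n (tabulate g) (H ∘ lookup) ⟩
    H (lookup (tabulate g))
      ≡⟨ H-resp (VecP.lookup∘tabulate g) ⟩
    H g ∎
    where open ≡-Reasoning

  -- wSet Γ P P? unfolds to sumWhere P? (wF Γ).
  sumWhere : {P : Par n → Set} → (∀ f → Dec (P f)) → (Par n → ℚ) → ℚ
  sumWhere P? H = ∑[ f ← allPar n ] ind (does (P? f)) (H f)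

  does-resp-≗ : ∀ {P : Par n → Set} (P? : ∀ f → Dec (P f)) → P Respects _≗_ →
    (λ f → does (P? f)) Preserves _≗_ ⟶ _≡_
  does-resp-≗ P? P-resp f≗g = does-≡ (P? _) (P? _) (mk⇔ (P-resp f≗g) (P-resp (sym ∘ f≗g)))

  sumWhere-cong : ∀ {P Q : Par n → Set} (P? : ∀ f → Dec (P f)) (Q? : ∀ f → Dec (Q f)) H →
    (∀ f → P f ⇔ Q f) → sumWhere P? H ≡ sumWhere Q? H
  sumWhere-cong P? Q? H P⇔Q =
    sumL-cong (allPar n) λ f → cong (λ c → ind c (H f)) (does-≡ (P? f) (Q? f) (P⇔Q f))

  sumWhere-pos : ∀ {P : Par n → Set} (P? : ∀ f → Dec (P f)) H →
    P Respects _≗_ → H Preserves _≗_ ⟶ _≡_ → (∀ f → P f → 0ℚ ℚ.< H f) → ∃ P → 0ℚ ℚ.< sumWhere P? H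
  sumWhere-pos P? H P-resp H-resp H>0 (g , Pg) = ℚP.<-≤-trans 0<term term≤sum
    where
    term : Par n → ℚ
    term f = ind (does (P? f)) (H f)
    term≤sum : ∑[ f ← allPar n ] ind (does (f ≗? g)) (term f) ℚ.≤ sumWhere P? H
    term≤sum = sumL-mono-≤ (allPar n) λ f →
      ind-≤ (does (f ≗? g)) (0≤ind (does (P? f)) (ℚP.<⇒≤ ∘ H>0 f ∘ dec-true⁻¹ (P? f)))
    0<term : 0ℚ ℚ.< ∑[ f ← allPar n ] ind (does (f ≗? g)) (term f)
    0<term rewrite allPar-enumerates g term (λ f≗f′ → cong₂ ind (does-resp-≗ P? P-resp f≗f′) (H-resp f≗f′))
                 | dec-true (P? g) Pg = H>0 g Pg

  module _ {P T Q : Par n → Set} (P? : ∀ f → Dec (P f)) (T? : ∀ t → Dec (T t)) (Q? : ∀ p → Dec (Q p))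
           (T-resp : T Respects _≗_) (Q-resp : Q Respects _≗_)
           (merge : Par n → Par n → Par n) (split₁ split₂ : Par n → Par n)
           (P⇔ : ∀ f → P f ⇔ (T (split₁ f) × Q (split₂ f)))
           (≗merge⇔ : ∀ f t p → T t → Q p → f ≗ merge t p ⇔ (t ≗ split₁ f × p ≗ split₂ f))
           (H : Par n → ℚ) (H-resp : H Preserves _≗_ ⟶ _≡_)
           where

    private
      AP = allPar n

      X : Par n → Par n → Par n → ℚ
      X f t p = ind (does (T? t)) (ind (does (Q? p)) (H f))

    merge-indicator : ∀ f t p → ind (does (f ≗? merge t p)) (X f t p)
                                ≡ ind (does (t ≗? split₁ f)) (ind (does (p ≗? split₂ f)) (X f t p))
    merge-indicator f t p with T? t | Q? p
    ... | yes Tt | yes Qp = trans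
      (cong (λ c → ind c (H f)) (does-≡ (f ≗? merge t p) ((t ≗? split₁ f) ×-dec (p ≗? split₂ f)) (≗merge⇔ f t p Tt Qp)))
      (ind-∧ (does (t ≗? split₁ f)) _ (H f))
    ... | yes _  | no _   = trans (ind-0 (does (f ≗? merge t p))) (sym (ind-ind-0 (does (t ≗? split₁ f)) _))
    ... | no _   | _      = trans (ind-0 (does (f ≗? merge t p))) (sym (ind-ind-0 (does (t ≗? split₁ f)) _))

    sum-over-splittings : ∀ f →
      ∑[ t ← AP ] ∑[ p ← AP ] ind (does (f ≗? merge t p)) (X f t p) ≡ ind (does (P? f)) (H f)
    sum-over-splittings f = begin
      ∑[ t ← AP ] ∑[ p ← AP ] ind (does (f ≗? merge t p)) (X f t p)
        ≡⟨ sumL-cong AP (λ t → trans (sumL-cong AP (merge-indicator f t))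
             (sym (ind-sumL AP (does (t ≗? split₁ f)) (λ p → ind (does (p ≗? split₂ f)) (X f t p))))) ⟩
      ∑[ t ← AP ] ind (does (t ≗? split₁ f)) (∑[ p ← AP ] ind (does (p ≗? split₂ f)) (X f t p))
        ≡⟨ sumL-cong AP (λ t → cong (ind (does (t ≗? split₁ f))) (allPar-enumerates (split₂ f) (X f t)
             (λ p≗p′ → cong (λ c → ind (does (T? t)) (ind c (H f))) (does-resp-≗ Q? Q-resp p≗p′)))) ⟩
      ∑[ t ← AP ] ind (does (t ≗? split₁ f)) (X f t (split₂ f))
        ≡⟨ allPar-enumerates (split₁ f) (λ t → X f t (split₂ f))
             (λ t≗t′ → cong (λ c → ind c (ind (does (Q? (split₂ f))) (H f))) (does-resp-≗ T? T-resp t≗t′)) ⟩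
      X f (split₁ f) (split₂ f)
        ≡⟨ sym (ind-∧ (does (T? (split₁ f))) _ (H f)) ⟩
      ind (does (T? (split₁ f) ×-dec Q? (split₂ f))) (H f)
        ≡⟨ cong (λ c → ind c (H f)) (does-≡ (T? (split₁ f) ×-dec Q? (split₂ f)) (P? f) (⇔-sym (P⇔ f))) ⟩
      ind (does (P? f)) (H f) ∎
      where open ≡-Reasoning

    sumWhere-decompose :
      sumWhere P? H ≡ ∑[ t ← AP ] ∑[ p ← AP ] ind (does (T? t)) (ind (does (Q? p)) (H (merge t p)))
    sumWhere-decompose = begin
      sumWhere P? H
        ≡⟨ sumL-cong AP (λ f → sym (sum-over-splittings f)) ⟩
      ∑[ f ← AP ] ∑[ t ← AP ] ∑[ p ← AP ] ind (does (f ≗? merge t p)) (X f t p)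
        ≡⟨ sumL-swap AP AP (λ f t → ∑[ p ← AP ] ind (does (f ≗? merge t p)) (X f t p)) ⟩
      ∑[ t ← AP ] ∑[ f ← AP ] ∑[ p ← AP ] ind (does (f ≗? merge t p)) (X f t p)
        ≡⟨ sumL-cong AP (λ t → sumL-swap AP AP (λ f p → ind (does (f ≗? merge t p)) (X f t p))) ⟩
      ∑[ t ← AP ] ∑[ p ← AP ] ∑[ f ← AP ] ind (does (f ≗? merge t p)) (X f t p)
        ≡⟨ sumL-cong AP (λ t → sumL-cong AP λ p → allPar-enumerates (merge t p) (λ f → X f t p)
             (cong (ind (does (T? t)) ∘ ind (does (Q? p))) ∘ H-resp)) ⟩
      ∑[ t ← AP ] ∑[ p ← AP ] X (merge t p) t p ∎
      where open ≡-Reasoning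

    sumWhere-product : (∀ t p → T t → Q p → H (merge t p) ≡ H t * H p) →
      sumWhere P? H ≡ sumWhere T? H * sumWhere Q? H
    sumWhere-product H-merge = begin
      sumWhere P? H
        ≡⟨ sumWhere-decompose ⟩
      ∑[ t ← AP ] ∑[ p ← AP ] ind (does (T? t)) (ind (does (Q? p)) (H (merge t p)))
        ≡⟨ sumL-cong AP (λ t → sumL-cong AP λ p → merge-term t p) ⟩
      ∑[ t ← AP ] ∑[ p ← AP ] (ind (does (T? t)) (H t) * ind (does (Q? p)) (H p))
        ≡⟨ sumL-product AP AP (λ t → ind (does (T? t)) (H t)) (λ p → ind (does (Q? p)) (H p)) ⟩
      sumWhere T? H * sumWhere Q? H ∎
      where
      open ≡-Reasoning
      merge-term : ∀ t p → ind (does (T? t)) (ind (does (Q? p)) (H (merge t p)))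
                           ≡ ind (does (T? t)) (H t) * ind (does (Q? p)) (H p)
      merge-term t p with T? t | Q? p
      ... | yes Tt | yes Qp = H-merge t p Tt Qp
      ... | yes _  | no _   = sym (ℚP.*-zeroʳ (H t))
      ... | no _   | Q?p    = sym (ℚP.*-zeroˡ (ind (does Q?p) (H p)))

  sumWhere-fibres : ∀ {P : Par n → Set} (P? : ∀ f → Dec (P f)) (c : Par n → Fin n → Bool) H →
    (∀ f → P f → ∃[ r ] (c f r ≡ true × ∀ j → c f j ≡ true → j ≡ r)) →
    ∑[ j ← List.allFin n ] ∑[ f ← allPar n ] ind (does (P? f) ∧ c f j) (H f) ≡ sumWhere P? H
  sumWhere-fibres {P} P? c H unique = begin
    ∑[ j ← List.allFin n ] ∑[ f ← allPar n ] ind (does (P? f) ∧ c f j) (H f)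
      ≡⟨ sumL-swap (List.allFin n) (allPar n) (λ j f → ind (does (P? f) ∧ c f j) (H f)) ⟩
    ∑[ f ← allPar n ] ∑[ j ← List.allFin n ] ind (does (P? f) ∧ c f j) (H f)
      ≡⟨ sumL-cong (allPar n) (λ f → trans (sumL-cong (List.allFin n) (λ j → ind-∧ (does (P? f)) (c f j) (H f)))
                                            (sym (ind-sumL (List.allFin n) (does (P? f)) (λ j → ind (c f j) (H f))))) ⟩
    ∑[ f ← allPar n ] ind (does (P? f)) (∑[ j ← List.allFin n ] ind (c f j) (H f))
      ≡⟨ sumL-cong (allPar n) (λ f → ind-cong (does (P? f)) (single f ∘ dec-true⁻¹ (P? f))) ⟩
    sumWhere P? H ∎
    where
    open ≡-Reasoning
    single : ∀ f → P f → ∑[ j ← List.allFin n ] ind (c f j) (H f) ≡ H f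
    single f Pf = let r , cr , only-r = unique f Pf in
      sumL-single FinP._≟_ {List.allFin n} (allFin-enumerates n) (c f) r (λ _ → H f) only-r cr

_≡ᵇ_ : ∀ {n} → Fin n → Fin n → Bool
x ≡ᵇ y = does (x FinP.≟ y)

count : ∀ n → (Fin n → Bool) → ℕ
count zero    p = 0
count (suc n) p = if p Fin.zero then suc (count n (p ∘ Fin.suc)) else count n (p ∘ Fin.suc)

countFin≡count : ∀ {n} (p : Fin n → Bool) → countFin p ≡ count n p
countFin≡count {n} p = go n (λ x → x) p
  where
  go : ∀ {A : Set} n (h : Fin n → A) (q : A → Bool) →
    List.length (List.filterᵇ q (List.tabulate h)) ≡ count n (q ∘ h)
  go zero    h q = refl
  go (suc n) h q with q (h Fin.zero)
  ... | true  = cong suc (go n (h ∘ Fin.suc) q)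
  ... | false = go n (h ∘ Fin.suc) q

count-cong : ∀ n {p q : Fin n → Bool} → p ≗ q → count n p ≡ count n q
count-cong zero    p≗q = refl
count-cong (suc n) {p} p≗q rewrite p≗q Fin.zero | count-cong n (p≗q ∘ Fin.suc) = refl

count-complement : ∀ n (p : Fin n → Bool) → count n p ℕ.+ count n (not ∘ p) ≡ n
count-complement zero    p = refl
count-complement (suc n) p with p Fin.zero
... | true  = cong suc (count-complement n (p ∘ Fin.suc))
... | false = trans (ℕP.+-suc (count n (p ∘ Fin.suc)) _) (cong suc (count-complement n (p ∘ Fin.suc)))

count-mono : ∀ n {p q : Fin n → Bool} → (∀ x → p x ≡ true → q x ≡ true) → count n p ≤ count n q
count-mono zero    p⇒q = z≤n
count-mono (suc n) {p} {q} p⇒q with p Fin.zero in p0 | q Fin.zero in q0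
... | true  | true  = s≤s (count-mono n (p⇒q ∘ Fin.suc))
... | true  | false = contradiction (trans (sym (p⇒q Fin.zero p0)) q0) λ ()
... | false | true  = ℕP.m≤n⇒m≤1+n (count-mono n (p⇒q ∘ Fin.suc))
... | false | false = count-mono n (p⇒q ∘ Fin.suc)

count-∨ : ∀ n (p q : Fin n → Bool) → (∀ x → p x ≡ true → q x ≢ true) →
  count n (λ x → p x ∨ q x) ≡ count n p ℕ.+ count n q
count-∨ zero    p q disj = refl
count-∨ (suc n) p q disj with p Fin.zero in p0 | q Fin.zero in q0
... | true  | true  = contradiction q0 (disj Fin.zero p0)
... | true  | false = cong suc (count-∨ n _ _ (disj ∘ Fin.suc))
... | false | true  = trans (cong suc (count-∨ n _ _ (disj ∘ Fin.suc))) (sym (ℕP.+-suc _ _))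
... | false | false = count-∨ n _ _ (disj ∘ Fin.suc)

count-remove : ∀ n (p : Fin n → Bool) j → p j ≡ true →
  count n p ≡ suc (count n (λ x → p x ∧ not (x ≡ᵇ j)))
count-remove (suc n) p Fin.zero    pj rewrite pj =
  cong suc (count-cong n λ x → sym (BoolP.∧-identityʳ (p (Fin.suc x))))
count-remove (suc n) p (Fin.suc j) pj with p Fin.zero
... | true  = cong suc (count-remove n (p ∘ Fin.suc) j pj)
... | false = count-remove n (p ∘ Fin.suc) j pj

count-pos : ∀ n (p : Fin n → Bool) j → p j ≡ true → 1 ≤ count n p
count-pos n p j pj rewrite count-remove n p j pj = s≤s z≤n

count-<-mono : ∀ n {p q : Fin n → Bool} j → (∀ x → p x ≡ true → q x ≡ true) →
  q j ≡ true → p j ≡ false → suc (count n p) ≤ count n q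
count-<-mono n {p} {q} j p⇒q qj pj rewrite count-remove n q j qj = s≤s (count-mono n p⇒q∖j)
  where
  p⇒q∖j : ∀ x → p x ≡ true → (q x ∧ not (x ≡ᵇ j)) ≡ true
  p⇒q∖j x px with x FinP.≟ j
  ... | yes refl = contradiction (trans (sym px) pj) λ ()
  ... | no _ rewrite p⇒q x px = refl

isRoot : ∀ {n} → Par n → Fin n → Bool
isRoot f x = not (is-just (f x))

arcCount≡count : ∀ {n} (f : Par n) → arcCount f ≡ count n (is-just ∘ f)
arcCount≡count f = countFin≡count (is-just ∘ f)

rootCount≡count : ∀ {n} (f : Par n) → rootCount f ≡ count n (isRoot f)
rootCount≡count f = countFin≡count (isRoot f)

arcCount+rootCount : ∀ {n} (f : Par n) → arcCount f ℕ.+ rootCount f ≡ n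
arcCount+rootCount {n} f
  rewrite arcCount≡count f | rootCount≡count f = count-complement n (is-just ∘ f)

arcCount≡n∸rootCount : ∀ {n} (f : Par n) → arcCount f ≡ n ∸ rootCount f
arcCount≡n∸rootCount {n} f =
  trans (sym (ℕP.m+n∸n≡m (arcCount f) (rootCount f))) (cong (_∸ rootCount f) (arcCount+rootCount f))

-- Ancestors in a parent function

Terminates : ∀ {n} → Par n → Fin n → Set
Terminates f x = ∃[ k ] anc f k x ≡ nothing

module _ {n : ℕ} where

  anc-suc : ∀ (f : Par n) k x → anc f (suc k) x ≡ (f x >>= anc f k)
  anc-suc f zero    x with f x
  ... | nothing = refl
  ... | just _  = refl
  anc-suc f (suc k) x rewrite anc-suc f k x with f x
  ... | nothing = refl
  ... | just _  = refl

  anc-parent : ∀ (f : Par n) k x {u} → f x ≡ just u → anc f (suc k) x ≡ anc f k u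
  anc-parent f k x fx≡u = trans (anc-suc f k x) (cong (_>>= anc f k) fx≡u)

  anc-root : ∀ (f : Par n) k x → f x ≡ nothing → anc f (suc k) x ≡ nothing
  anc-root f k x fx≡nothing = trans (anc-suc f k x) (cong (_>>= anc f k) fx≡nothing)

  anc-nothing : ∀ (f : Par n) {k} x d → anc f k x ≡ nothing → anc f (d ℕ.+ k) x ≡ nothing
  anc-nothing f x zero    e = e
  anc-nothing f x (suc d) e = cong (_>>= f) (anc-nothing f x d e)

  anc-nothing-≤ : ∀ (f : Par n) {k l} x → k ≤ l → anc f k x ≡ nothing → anc f l x ≡ nothing
  anc-nothing-≤ f {k} {l} x k≤l e = subst (λ m → anc f m x ≡ nothing) (ℕP.m∸n+n≡m k≤l) (anc-nothing f x (l ∸ k) e)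

  anc-+ : ∀ (f : Par n) {a} x {y} c → anc f a x ≡ just y → anc f (c ℕ.+ a) x ≡ anc f c y
  anc-+ f x zero    e = e
  anc-+ f x (suc c) e = cong (_>>= f) (anc-+ f x c e)

  anc-cong : ∀ {f g : Par n} → f ≗ g → ∀ k x → anc f k x ≡ anc g k x
  anc-cong f≗g zero    x = refl
  anc-cong {g = g} f≗g (suc k) x rewrite anc-cong f≗g k x with anc g k x
  ... | nothing = refl
  ... | just y  = f≗g y

  terminates-parent : ∀ (f : Par n) x {u} → f x ≡ just u → Terminates f u → Terminates f x
  terminates-parent f x fx≡u (k , e) = suc k , trans (anc-parent f k x fx≡u) e

  terminates-root : ∀ (f : Par n) x → f x ≡ nothing → Terminates f x
  terminates-root f x e = 1 , e

  repeat⇒circuit : ∀ (f : Par n) x {y} a b → a < b → b ≤ n →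
    anc f a x ≡ just y → anc f b x ≡ just y → ¬ NoCircuit f
  repeat⇒circuit f x {y} a b a<b b≤n ea eb noCircuit = noCircuit y (fromℕ< d<n) circuit
    where
    d = proj₁ (ℕP.m≤n⇒∃[o]m+o≡n a<b)
    b≡ : suc d ℕ.+ a ≡ b
    b≡ = trans (cong suc (ℕP.+-comm d a)) (proj₂ (ℕP.m≤n⇒∃[o]m+o≡n a<b))
    d<n : d < n
    d<n = ℕP.≤-trans (s≤s (ℕP.m≤m+n d a)) (subst (_≤ n) (sym b≡) b≤n)
    circuit : anc f (suc (toℕ (fromℕ< d<n))) y ≡ just y
    circuit = begin
      anc f (suc (toℕ (fromℕ< d<n))) y  ≡⟨ cong (λ k → anc f (suc k) y) (FinP.toℕ-fromℕ< d<n) ⟩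
      anc f (suc d) y                   ≡⟨ sym (anc-+ f x (suc d) ea) ⟩
      anc f (suc d ℕ.+ a) x             ≡⟨ cong (λ k → anc f k x) b≡ ⟩
      anc f b x                         ≡⟨ eb ⟩
      just y                            ∎
      where open ≡-Reasoning

  noCircuit⇒terminates-within : ∀ (f : Par n) → NoCircuit f → ∀ x → ∃[ k ] (k ≤ n × anc f k x ≡ nothing)
  noCircuit⇒terminates-within f noCircuit x
    with FinP.any? {n = suc n} (λ k → MaybeP.≡-dec FinP._≟_ (anc f (toℕ k) x) nothing)
  ... | yes (k , e) = toℕ k , FinP.toℕ≤pred[n] k , e
  ... | no  ¬e = contradiction noCircuit (repeat⇒circuit f x (toℕ i) (toℕ j) i<j (FinP.toℕ≤pred[n] j)
                   (proj₂ (ancestor i)) (trans (proj₂ (ancestor j)) (cong just (sym hi≡hj))))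
    where
    ancestor : ∀ k → Σ (Fin n) λ y → anc f (toℕ k) x ≡ just y
    ancestor k with anc f (toℕ k) x in e
    ... | just y  = y , refl
    ... | nothing = contradiction (k , e) ¬e
    pigeon = FinP.pigeonhole (ℕP.n<1+n n) (proj₁ ∘ ancestor)
    i = proj₁ pigeon
    j = proj₁ (proj₂ pigeon)
    i<j = proj₁ (proj₂ (proj₂ pigeon))
    hi≡hj = proj₂ (proj₂ (proj₂ pigeon))

  noCircuit⇒terminates : ∀ (f : Par n) → NoCircuit f → ∀ x → Terminates f x
  noCircuit⇒terminates f noCircuit x =
    let k , _ , e = noCircuit⇒terminates-within f noCircuit x in k , e

  anc-* : ∀ (f : Par n) x c q → anc f c x ≡ just x → anc f (q ℕ.* c) x ≡ just x
  anc-* f x c zero    e = refl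
  anc-* f x c (suc q) e = trans (anc-+ f x c (anc-* f x c q e)) e

  -- A circuit through x, repeated m times, would outlast termination after m steps.
  terminates⇒noCircuit : ∀ (f : Par n) → (∀ x → Terminates f x) → NoCircuit f
  terminates⇒noCircuit f terminates x k circuit with terminates x
  ... | m , e = contradiction (trans (sym (anc-* f x c m circuit))
                               (anc-nothing-≤ f x (ℕP.m≤m*n m c) e)) λ ()
    where c = suc (toℕ k)

  root-within : ∀ (f : Par n) i K → anc f K i ≡ nothing →
    ∃[ r ] ∃[ l ] (l < K × anc f l i ≡ just r × f r ≡ nothing)
  root-within f i (suc K) e with anc f K i in eK
  ... | just r  = r , K , ℕP.n<1+n K , eK , e
  ... | nothing = let r , l , l<K , rest = root-within f i K eK in r , l , ℕP.m≤n⇒m≤1+n l<K , rest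

  root-of : ∀ (f : Par n) → NoCircuit f → ∀ i → ∃[ r ] (f r ≡ nothing × ForestReach f r i)
  root-of f noCircuit i with noCircuit⇒terminates-within f noCircuit i
  ... | K , K≤n , eK with root-within f i K eK
  ... | r , l , l<K , e , fr = r , fr , fromℕ< l<n , trans (cong (λ k → anc f k i) (FinP.toℕ-fromℕ< l<n)) e
    where l<n = ℕP.<-≤-trans l<K K≤n

  root-unique : ∀ (f : Par n) {i r r′} a b → f r ≡ nothing → f r′ ≡ nothing →
    anc f a i ≡ just r → anc f b i ≡ just r′ → r ≡ r′
  root-unique f {i} a b fr fr′ ea eb with ℕP.<-cmp a b
  ... | tri≈ _ refl _ = MaybeP.just-injective (trans (sym ea) eb)
  ... | tri< a<b _ _  =
    contradiction (trans (sym eb) (anc-nothing-≤ f i a<b (trans (cong (_>>= f) ea) fr))) λ ()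
  ... | tri> _ _ b<a  =
    contradiction (trans (sym ea) (anc-nothing-≤ f i b<a (trans (cong (_>>= f) eb) fr′))) λ ()

  ParentClosed : Par n → (Fin n → Set) → Set
  ParentClosed f D = ∀ x u → D x → f x ≡ just u → D u

  anc-closed : ∀ {f : Par n} {D : Fin n → Set} → ParentClosed f D →
    ∀ k x {y} → D x → anc f k x ≡ just y → D y
  anc-closed closed zero    x Dx refl = Dx
  anc-closed {f} closed (suc k) x Dx e with anc f k x in ek
  ... | just z = closed z _ (anc-closed closed k x Dx ek) e

  anc-agree : ∀ {f g : Par n} {D : Fin n → Set} → ParentClosed f D → (∀ x → D x → g x ≡ f x) →
    ∀ k x → D x → anc g k x ≡ anc f k x
  anc-agree closed g≡f zero    x Dx = refl
  anc-agree {f} closed g≡f (suc k) x Dx rewrite anc-agree closed g≡f k x Dx with anc f k x in ek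
  ... | nothing = refl
  ... | just z  = g≡f z (anc-closed closed k x Dx ek)

  _⊑_ : Par n → Par n → Set
  g ⊑ f = ∀ x → g x ≡ nothing ⊎ g x ≡ f x

  anc-⊑ : ∀ {f g : Par n} → g ⊑ f → ∀ k x {y} → anc g k x ≡ just y → anc f k x ≡ just y
  anc-⊑ g⊑f zero    x e = e
  anc-⊑ {f} {g} g⊑f (suc k) x e with anc g k x in ek
  ... | just z rewrite anc-⊑ g⊑f k x ek with g⊑f z
  ...   | inj₁ gz≡nothing = contradiction (trans (sym e) gz≡nothing) λ ()
  ...   | inj₂ gz≡fz      = trans (sym gz≡fz) e

  noCircuit-⊑ : ∀ {f g : Par n} → g ⊑ f → NoCircuit f → NoCircuit g
  noCircuit-⊑ g⊑f noCircuit x k = noCircuit x k ∘ anc-⊑ g⊑f (suc (toℕ k)) x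

  reach-trans : ∀ {D : Digraph n} {a b c} → Reach D a b → Reach D b c → Reach D a c
  reach-trans a↝b here           = a↝b
  reach-trans a↝b (step b↝u u→c) = step (reach-trans a↝b b↝u) u→c

  reach-mono : ∀ {D E : Digraph n} → (∀ u w → arc D u w ≡ true → arc E u w ≡ true) →
    ∀ {a b} → Reach D a b → Reach E a b
  reach-mono D⊆E here           = here
  reach-mono D⊆E (step a↝u u→b) = step (reach-mono D⊆E a↝u) (D⊆E _ _ u→b)

  anc⇒reach : ∀ (D : Digraph n) {f : Par n} → ArcsIn (arc D) f → ∀ k i {z} → anc f k i ≡ just z → Reach D z i
  anc⇒reach D           arcs zero    i refl = here
  anc⇒reach D {f} arcs (suc k) i e with f i in fi
  ... | just p  = step (anc⇒reach D arcs k p (trans (sym (anc-parent f k i fi)) e)) (arcs i p fi)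
  ... | nothing = contradiction (trans (sym e) (anc-root f k i fi)) λ ()

  forestReach⇒reach : ∀ (D : Digraph n) {f : Par n} → ArcsIn (arc D) f → ∀ {z i} → ForestReach f z i → Reach D z i
  forestReach⇒reach D arcs {i = i} (k , e) = anc⇒reach D arcs (toℕ k) i e

  forestReach-refl : ∀ (f : Par n) x → ForestReach f x x
  forestReach-refl f x = fromℕ< 0<n , cong (λ k → anc f k x) (FinP.toℕ-fromℕ< 0<n)
    where 0<n = ℕP.≤-<-trans z≤n (FinP.toℕ<n x)

  arcsIn-resp : ∀ A → ArcsIn {n} A Respects _≗_
  arcsIn-resp A f≗g arcs v u gv = arcs v u (trans (f≗g v) gv)

  noCircuit-resp : NoCircuit {n} Respects _≗_
  noCircuit-resp f≗g noCircuit v k = noCircuit v k ∘ trans (anc-cong f≗g (suc (toℕ k)) v)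

  isDivForest-resp : ∀ A → IsDivForest {n} A Respects _≗_
  isDivForest-resp A f≗g (arcs , noCircuit) = arcsIn-resp A f≗g arcs , noCircuit-resp f≗g noCircuit

  arcCount-resp : arcCount {n} Preserves _≗_ ⟶ _≡_
  arcCount-resp {f} {g} f≗g = trans (arcCount≡count f)
    (trans (count-cong n (cong is-just ∘ f≗g)) (sym (arcCount≡count g)))

  forestReach-resp : ∀ z i → (λ f → ForestReach {n} f z i) Respects _≗_
  forestReach-resp z i f≗g (k , e) = k , trans (sym (anc-cong f≗g (toℕ k) i)) e

  inTree-resp : ∀ j i → (λ f → InTree {n} f j i) Respects _≗_
  inTree-resp j i f≗g (fj , reach) = trans (sym (f≗g j)) fj , forestReach-resp j i f≗g reach

  wF-resp : ∀ (Γ : Digraph n) → wF Γ Preserves _≗_ ⟶ _≡_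
  wF-resp Γ f≗g = prodL-cong (List.allFin n) λ v → cong (maybe (λ u → wt Γ u v) 1ℚ) (f≗g v)

-- Growing forests

∨-trueˡ : ∀ a {b} → a ≡ true → (a ∨ b) ≡ true
∨-trueˡ true _ = refl

∨-trueʳ : ∀ a {b} → b ≡ true → (a ∨ b) ≡ true
∨-trueʳ true  _ = refl
∨-trueʳ false e = e

module Growth {n : ℕ} (D : Digraph n) where

  record ForestOn (f : Par n) (C : Fin n → Bool) : Set where
    field
      arcs          : ArcsIn (arc D) f
      terminates    : ∀ x → Terminates f x
      root-outside  : ∀ x → C x ≡ false → f x ≡ nothing
      parent-inside : ∀ x u → f x ≡ just u → C u ≡ true

  emptyForestOn : ∀ C → ForestOn (λ _ → nothing) C
  emptyForestOn C = record
    { arcs = λ _ _ () ; terminates = λ x → terminates-root _ x refl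
    ; root-outside = λ _ _ → refl ; parent-inside = λ _ _ () }

  record Extension (f : Par n) (C : Fin n → Bool) : Set where
    field
      g           : Par n
      C′          : Fin n → Bool
      forestOn    : ForestOn g C′
      ⊇C          : ∀ x → C x ≡ true → C′ x ≡ true
      agrees      : ∀ x → C x ≡ true → g x ≡ f x
      new-nonroot : ∀ x → C′ x ≡ true → C x ≡ false → ∃[ u ] g x ≡ just u
      closed      : ∀ u w → C′ u ≡ true → arc D u w ≡ true → C′ w ≡ true

  LeavingArc : (Fin n → Bool) → Set
  LeavingArc C = ∃[ u ] ∃[ w ] ((C u ≡ true × C w ≡ false) × arc D u w ≡ true)

  leavingArc? : ∀ C → Dec (LeavingArc C)
  leavingArc? C = FinP.any? λ u → FinP.any? λ w →
    ((C u BoolP.≟ true) ×-dec (C w BoolP.≟ false)) ×-dec (arc D u w BoolP.≟ true)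

  trivialExtension : ∀ {f C} → ForestOn f C → ¬ LeavingArc C → Extension f C
  trivialExtension {f} {C} forestOn noLeaving = record
    { g = f ; C′ = C ; forestOn = forestOn ; ⊇C = λ _ e → e ; agrees = λ _ _ → refl
    ; new-nonroot = λ _ e e′ → contradiction (trans (sym e) e′) λ ()
    ; closed = closed }
    where
    closed : ∀ u w → C u ≡ true → arc D u w ≡ true → C w ≡ true
    closed u w Cu u→w with C w in Cw
    ... | true  = refl
    ... | false = contradiction (u , w , (Cu , Cw) , u→w) noLeaving

  module AddArc {f : Par n} {C : Fin n → Bool} (forestOn : ForestOn f C) (u w : Fin n)
                (Cu : C u ≡ true) (Cw : C w ≡ false) (u→w : arc D u w ≡ true) where
    open ForestOn forestOn

    f⁺ : Par n
    f⁺ x = if x ≡ᵇ w then just u else f x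

    C⁺ : Fin n → Bool
    C⁺ x = C x ∨ (x ≡ᵇ w)

    f⁺-inside : ∀ x → C x ≡ true → f⁺ x ≡ f x
    f⁺-inside x Cx with x FinP.≟ w
    ... | yes refl = contradiction (trans (sym Cx) Cw) λ ()
    ... | no  _    = refl

    terminates-inside : ∀ x → C x ≡ true → Terminates f⁺ x
    terminates-inside x Cx with terminates x
    ... | k , e = k , trans (anc-agree (λ y v _ → parent-inside y v) f⁺-inside k x Cx) e

    forestOn⁺ : ForestOn f⁺ C⁺
    ForestOn.arcs forestOn⁺ x v e with x FinP.≟ w
    ForestOn.arcs forestOn⁺ x v refl | yes refl = u→w
    ForestOn.arcs forestOn⁺ x v e    | no  _    = arcs x v e
    ForestOn.terminates forestOn⁺ x with x FinP.≟ w | C x in Cx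
    ... | yes refl | _     = terminates-parent f⁺ x (f⁺-w) (terminates-inside u Cu)
      where f⁺-w : f⁺ w ≡ just u
            f⁺-w rewrite dec-true (w FinP.≟ w) refl = refl
    ... | no  _    | true  = terminates-inside x Cx
    ... | no  x≢w  | false = terminates-root f⁺ x (trans (f⁺-outside x≢w) (root-outside x Cx))
      where f⁺-outside : x ≢ w → f⁺ x ≡ f x
            f⁺-outside x≢w rewrite dec-false (x FinP.≟ w) x≢w = refl
    ForestOn.root-outside forestOn⁺ x e with C x in Cx | x FinP.≟ w
    ... | false | no _ = root-outside x Cx
    ForestOn.parent-inside forestOn⁺ x v e with x FinP.≟ w
    ForestOn.parent-inside forestOn⁺ x v refl | yes refl = ∨-trueˡ (C u) Cu
    ForestOn.parent-inside forestOn⁺ x v e    | no  _    = ∨-trueˡ (C v) (parent-inside x v e)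

    fewer-outside : suc (count n (not ∘ C⁺)) ≤ count n (not ∘ C)
    fewer-outside = count-<-mono n w outside⁺⇒outside (cong not Cw) (C⁺w)
      where
      outside⁺⇒outside : ∀ x → not (C⁺ x) ≡ true → not (C x) ≡ true
      outside⁺⇒outside x e with C x
      ... | false = refl
      ... | true  = e
      C⁺w : not (C⁺ w) ≡ false
      C⁺w rewrite dec-true (w FinP.≟ w) refl | BoolP.∨-zeroʳ (C w) = refl

  extend-within : ∀ fuel {f C} → count n (not ∘ C) ≤ fuel → ForestOn f C → Extension f C
  extend-within zero {C = C} few forestOn = trivialExtension forestOn noLeaving
    where
    noLeaving : ¬ LeavingArc C
    noLeaving (u , w , (_ , Cw) , _) =
      contradiction (ℕP.≤-trans (count-pos n (not ∘ C) w (cong not Cw)) few) λ ()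
  extend-within (suc fuel) {f} {C} few forestOn with leavingArc? C
  ... | no  noLeaving = trivialExtension forestOn noLeaving
  ... | yes (u , w , (Cu , Cw) , u→w) = record
    { g = E.g ; C′ = E.C′ ; forestOn = E.forestOn
    ; ⊇C = λ x Cx → E.⊇C x (∨-trueˡ (C x) Cx)
    ; agrees = λ x Cx → trans (E.agrees x (∨-trueˡ (C x) Cx)) (A.f⁺-inside x Cx)
    ; new-nonroot = new-nonroot
    ; closed = E.closed }
    where
    module A = AddArc forestOn u w Cu Cw u→w
    E = extend-within fuel (ℕP.≤-pred (ℕP.≤-trans A.fewer-outside few)) A.forestOn⁺
    module E = Extension E
    new-nonroot : ∀ x → E.C′ x ≡ true → C x ≡ false → ∃[ v ] E.g x ≡ just v
    new-nonroot x C′x Cx with x ≡ᵇ w in x≡w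
    ... | true  = u , trans (E.agrees x (∨-trueʳ (C x) x≡w)) (cong (λ b → if b then just u else f x) x≡w)
    ... | false = E.new-nonroot x C′x (cong₂ _∨_ Cx x≡w)

  extend : ∀ {f C} → ForestOn f C → Extension f C
  extend {C = C} = extend-within n (ℕP.≤-trans (ℕP.m≤n+m _ (count n C))
                                      (ℕP.≤-reflexive (count-complement n C)))

  module _ {f : Par n} {C : Fin n → Bool} (E : Extension f C) where
    open Extension E
    open ForestOn forestOn

    extension-covers : ∀ {s x} → Reach D s x → C s ≡ true → C′ x ≡ true
    extension-covers here           Cs = ⊇C _ Cs
    extension-covers (step s↝u u→x) Cs = closed _ _ (extension-covers s↝u Cs) u→x

    extension-isDivForest : IsDivForest (arc D) g
    extension-isDivForest = arcs , terminates⇒noCircuit g terminates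

    extension-root : ∀ x → g x ≡ nothing → C′ x ≡ true → C x ≡ true × f x ≡ nothing
    extension-root x gx C′x with C x in Cx
    ... | true  = refl , trans (sym (agrees x Cx)) gx
    ... | false = contradiction (trans (sym (proj₂ (new-nonroot x C′x Cx))) gx) λ ()

    extension-root-of : ∀ x → C′ x ≡ true →
      ∃[ r ] ((g r ≡ nothing × ForestReach g r x) × (C r ≡ true × f r ≡ nothing))
    extension-root-of x C′x with root-of g (proj₂ extension-isDivForest) x
    ... | r , gr , (k , e) = r , (gr , (k , e)) ,
      extension-root r gr (anc-closed (λ y v _ → parent-inside y v) (toℕ k) x C′x e)

  fromVertex : ∀ z → Extension (λ _ → nothing) (_≡ᵇ z)
  fromVertex z = extend (emptyForestOn (_≡ᵇ z))

  module _ {z : Fin n} where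
    open Extension (fromVertex z)

    private
      zz : (z ≡ᵇ z) ≡ true
      zz = dec-true (z FinP.≟ z) refl

    fromVertex-root : g z ≡ nothing
    fromVertex-root = agrees z zz

    fromVertex-covers : ∀ {x} → Reach D z x → C′ x ≡ true
    fromVertex-covers z↝x = extension-covers (fromVertex z) z↝x zz

    fromVertex-reach : ∀ {x} → Reach D z x → ForestReach g z x
    fromVertex-reach {x} z↝x with extension-root-of (fromVertex z) x (fromVertex-covers z↝x)
    ... | r , (_ , k , e) , (r≡z , _) = k , trans e (cong just (dec-true⁻¹ (r FinP.≟ z) r≡z))

-- Maximum out forests

rootCount-≤⇒arcCount-≥ : ∀ {n} (f g : Par n) → rootCount g ≤ rootCount f → arcCount f ≤ arcCount g
rootCount-≤⇒arcCount-≥ {n} f g fewer = ℕP.+-cancelʳ-≤ (rootCount g) (arcCount f) (arcCount g) (begin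
  arcCount f ℕ.+ rootCount g  ≤⟨ ℕP.+-monoʳ-≤ (arcCount f) fewer ⟩
  arcCount f ℕ.+ rootCount f  ≡⟨ arcCount+rootCount f ⟩
  n                           ≡⟨ arcCount+rootCount g ⟨
  arcCount g ℕ.+ rootCount g  ∎)
  where open ℕP.≤-Reasoning

rootCount-<⇒arcCount-> : ∀ {n} (f g : Par n) → rootCount g < rootCount f → arcCount f < arcCount g
rootCount-<⇒arcCount-> {n} f g fewer = ℕP.+-cancelʳ-≤ (rootCount g) (suc (arcCount f)) (arcCount g) (begin
  suc (arcCount f ℕ.+ rootCount g)  ≡⟨ ℕP.+-suc (arcCount f) (rootCount g) ⟨
  arcCount f ℕ.+ suc (rootCount g)  ≤⟨ ℕP.+-monoʳ-≤ (arcCount f) fewer ⟩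
  arcCount f ℕ.+ rootCount f        ≡⟨ arcCount+rootCount f ⟩
  n                                 ≡⟨ arcCount+rootCount g ⟨
  arcCount g ℕ.+ rootCount g        ∎)
  where open ℕP.≤-Reasoning

isRoot-true : ∀ {n} (f : Par n) {x} → f x ≡ nothing → isRoot f x ≡ true
isRoot-true f fx rewrite fx = refl

isRoot-true⁻¹ : ∀ {n} (f : Par n) x → isRoot f x ≡ true → f x ≡ nothing
isRoot-true⁻¹ f x e with f x
... | nothing = refl

∈-tabulate : ∀ {n} (b : Fin n → Bool) {x} → b x ≡ true → x ∈ tabulate b
∈-tabulate b {x} bx = VecP.lookup⇒[]= x (tabulate b) (trans (VecP.lookup∘tabulate b x) bx)

∈-tabulate⁻¹ : ∀ {n} (b : Fin n → Bool) {x} → x ∈ tabulate b → b x ≡ true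
∈-tabulate⁻¹ b {x} x∈ = trans (sym (VecP.lookup∘tabulate b x)) (VecP.[]=⇒lookup x∈)

module MaxForests {n : ℕ} (D : Digraph n) where
  open Growth D

  IsMax : Par n → Set
  IsMax = IsMaxOutForest (arc D)

  isMax-sameCount : ∀ {f₀ f} → IsMax f₀ → IsDivForest (arc D) f → arcCount f ≡ arcCount f₀ → IsMax f
  isMax-sameCount (_ , maximal) isForest f≡f₀ = isForest , λ g isForestg →
    subst (arcCount g ≤_) (sym f≡f₀) (maximal g isForestg)

  reach? : ∀ z w → Dec (Reach D z w)
  reach? z w with Extension.C′ (fromVertex z) w in C′w
  ... | false = no λ z↝w → contradiction (trans (sym (fromVertex-covers z↝w)) C′w) λ ()
  ... | true with extension-root-of (fromVertex z) w C′w
  ... | r , (_ , r↝w) , (r≡z , _) = yes (subst (λ q → Reach D q w) (dec-true⁻¹ (r FinP.≟ z) r≡z)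
          (forestReach⇒reach D (proj₁ (extension-isDivForest (fromVertex z))) r↝w))

  -- Growing a forest from the roots other than r covers every vertex (r itself is reached from r′),
  -- and it has one root fewer than f.
  roots-unreachable : ∀ {f} → IsMax f → ∀ {r r′} → f r ≡ nothing → f r′ ≡ nothing → r′ ≢ r →
    ¬ Reach D r′ r
  roots-unreachable {f} ((arcs , noCircuit) , maximal) {r} {r′} fr fr′ r′≢r r′↝r =
    ℕP.<⇒≱ (rootCount-<⇒arcCount-> f (Extension.g E) fewerRoots) (maximal _ (extension-isDivForest E))
    where
    otherRoot : Fin n → Bool
    otherRoot x = isRoot f x ∧ not (x ≡ᵇ r)
    E = extend (emptyForestOn otherRoot)
    open Extension E using (g; C′)
    isOtherRoot : ∀ {x} → f x ≡ nothing → x ≢ r → otherRoot x ≡ true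
    isOtherRoot {x} fx x≢r rewrite isRoot-true f fx | dec-false (x FinP.≟ r) x≢r = refl
    covered : ∀ x → C′ x ≡ true
    covered x with root-of f noCircuit x
    ... | ρ , fρ , ρ↝x with ρ FinP.≟ r
    ... | yes refl = extension-covers E (reach-trans r′↝r (forestReach⇒reach D arcs ρ↝x)) (isOtherRoot fr′ r′≢r)
    ... | no  ρ≢r  = extension-covers E (forestReach⇒reach D arcs ρ↝x) (isOtherRoot fρ ρ≢r)
    roots⊆otherRoot : ∀ x → isRoot g x ≡ true → otherRoot x ≡ true
    roots⊆otherRoot x gx = proj₁ (extension-root E x (isRoot-true⁻¹ g x gx) (covered x))
    fewerRoots : rootCount g < rootCount f
    fewerRoots = begin-strict
      rootCount g               ≡⟨ rootCount≡count g ⟩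
      count n (isRoot g)        ≤⟨ count-mono n roots⊆otherRoot ⟩
      count n otherRoot         <⟨ ℕP.n<1+n _ ⟩
      suc (count n otherRoot)   ≡⟨ sym (count-remove n (isRoot f) r (isRoot-true f fr)) ⟩
      count n (isRoot f)        ≡⟨ sym (rootCount≡count f) ⟩
      rootCount f               ∎
      where open ℕP.≤-Reasoning

  reaches-root⇒reached : ∀ {f} → IsMax f → ∀ {j u} → f j ≡ nothing → Reach D u j → Reach D j u
  reaches-root⇒reached {f} isMax@((arcs , noCircuit) , _) {j} {u} fj u↝j with root-of f noCircuit u
  ... | r , fr , r↝u with r FinP.≟ j
  ... | yes refl = forestReach⇒reach D arcs r↝u
  ... | no  r≢j  = contradiction (reach-trans (forestReach⇒reach D arcs r↝u) u↝j) (roots-unreachable isMax fj fr r≢j)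

  knot-predecessor : ∀ {K} → UndomKnot D K → ∀ {u w} → arc D u w ≡ true → w ∈ K → u ∈ K
  knot-predecessor {K} (_ , _ , noArcIn) {u} {w} u→w w∈K with u ∈? K
  ... | yes u∈K = u∈K
  ... | no  u∉K = contradiction (trans (sym u→w) (noArcIn u w u∉K w∈K)) λ ()

  knot-parentClosed : ∀ {f K} → ArcsIn (arc D) f → UndomKnot D K → ParentClosed f (_∈ K)
  knot-parentClosed arcs undomKnot x u x∈K fx = knot-predecessor undomKnot (arcs x u fx) x∈K

  knot-contains-root : ∀ {f} → IsDivForest (arc D) f → ∀ {K} → UndomKnot D K → ∃[ r ] (r ∈ K × f r ≡ nothing)
  knot-contains-root {f} (arcs , noCircuit) undomKnot@((k , k∈K) , _) with root-of f noCircuit k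
  ... | r , fr , (l , e) = r , anc-closed (knot-parentClosed arcs undomKnot) (toℕ l) k k∈K e , fr

  knot-root-unique : ∀ {f} → IsMax f → ∀ {K} → UndomKnot D K → ∀ {r₁ r₂} →
    r₁ ∈ K → r₂ ∈ K → f r₁ ≡ nothing → f r₂ ≡ nothing → r₁ ≡ r₂
  knot-root-unique isMax (_ , mutualReach , _) {r₁} {r₂} r₁∈K r₂∈K fr₁ fr₂ with r₁ FinP.≟ r₂
  ... | yes r₁≡r₂ = r₁≡r₂
  ... | no  r₁≢r₂ = contradiction (mutualReach r₁ r₂ r₁∈K r₂∈K) (roots-unreachable isMax fr₂ fr₁ r₁≢r₂)

  knotOf : Fin n → Subset n
  knotOf j = tabulate (λ x → does (reach? x j) ∧ does (reach? j x))

  ∈-knotOf : ∀ {j x} → Reach D x j → Reach D j x → x ∈ knotOf j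
  ∈-knotOf {j} {x} x↝j j↝x = ∈-tabulate _ (cong₂ _∧_ (dec-true (reach? x j) x↝j) (dec-true (reach? j x) j↝x))

  ∈-knotOf⁻¹ : ∀ {j x} → x ∈ knotOf j → Reach D x j × Reach D j x
  ∈-knotOf⁻¹ {j} {x} x∈ with reach? x j | reach? j x | ∈-tabulate⁻¹ _ x∈
  ... | yes x↝j | yes j↝x | _ = x↝j , j↝x

  knotOf-root : ∀ {f} → IsMax f → ∀ {j} → f j ≡ nothing → UndomKnot D (knotOf j) × j ∈ knotOf j
  knotOf-root isMax {j} fj = ((j , j∈) , mutualReach , noArcIn) , j∈
    where
    j∈ = ∈-knotOf here here
    mutualReach : ∀ a b → a ∈ knotOf j → b ∈ knotOf j → Reach D a b
    mutualReach a b a∈ b∈ = reach-trans (proj₁ (∈-knotOf⁻¹ a∈)) (proj₂ (∈-knotOf⁻¹ b∈))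
    noArcIn : ∀ u w → u ∉ knotOf j → w ∈ knotOf j → arc D u w ≡ false
    noArcIn u w u∉ w∈ with arc D u w in u→w
    ... | false = refl
    ... | true  = contradiction (∈-knotOf u↝j (reaches-root⇒reached isMax fj u↝j)) u∉
      where u↝j = reach-trans (step here u→w) (proj₁ (∈-knotOf⁻¹ w∈))

  -- Grow a tree from j over everything j reaches, then let the roots of f₀ outside that tree
  -- grow the rest: the root of f₀ in K is absorbed by the tree, so no root is gained.
  module TreeInMaxForest {f₀} (isMax₀ : IsMax f₀) {K} (undomKnot : UndomKnot D K) {j} (j∈K : j ∈ K) where
    private
      arcs₀ = proj₁ (proj₁ isMax₀)
      noCircuit₀ = proj₂ (proj₁ isMax₀)
      jj : (j ≡ᵇ j) ≡ true
      jj = dec-true (j FinP.≟ j) refl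

    module E₁ = Extension (fromVertex j)

    forestOn₂ : ForestOn E₁.g (λ x → E₁.C′ x ∨ isRoot f₀ x)
    forestOn₂ = record
      { arcs = ForestOn.arcs E₁.forestOn ; terminates = ForestOn.terminates E₁.forestOn
      ; root-outside = λ x C₂x → ForestOn.root-outside E₁.forestOn x (BoolP.∨-conicalˡ _ _ C₂x)
      ; parent-inside = λ x u gx → ∨-trueˡ (E₁.C′ u) (ForestOn.parent-inside E₁.forestOn x u gx) }

    E₂ = extend forestOn₂
    module E₂ = Extension E₂
    g = E₂.g

    covered : ∀ x → E₂.C′ x ≡ true
    covered x with root-of f₀ noCircuit₀ x
    ... | ρ , fρ , ρ↝x =
      extension-covers E₂ (forestReach⇒reach D arcs₀ ρ↝x) (∨-trueʳ (E₁.C′ ρ) (isRoot-true f₀ fρ))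

    newRoot : Fin n → Bool
    newRoot x = (x ≡ᵇ j) ∨ (isRoot f₀ x ∧ not (E₁.C′ x))

    roots⊆newRoot : ∀ x → isRoot g x ≡ true → newRoot x ≡ true
    roots⊆newRoot x gx with extension-root E₂ x (isRoot-true⁻¹ g x gx) (covered x)
    ... | C₂x , g₁x with E₁.C′ x in C′x
    ...   | true  = ∨-trueˡ _ (proj₁ (extension-root (fromVertex j) x g₁x C′x))
    ...   | false = ∨-trueʳ (x ≡ᵇ j) (trans (cong (_∧ true) C₂x) (BoolP.∧-identityʳ _))

    fewerRoots : rootCount g ≤ rootCount f₀
    fewerRoots = begin
      rootCount g                                       ≡⟨ rootCount≡count g ⟩
      count n (isRoot g)                                ≤⟨ count-mono n roots⊆newRoot ⟩
      count n newRoot                                   ≡⟨ count-remove n newRoot j (∨-trueˡ _ jj) ⟩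
      suc (count n (λ x → newRoot x ∧ not (x ≡ᵇ j)))    ≤⟨ s≤s (count-mono n newRoot∖j⊆roots∖r₀) ⟩
      suc (count n (λ x → isRoot f₀ x ∧ not (x ≡ᵇ r₀)))
        ≡⟨ sym (count-remove n (isRoot f₀) r₀ (isRoot-true f₀ fr₀)) ⟩
      count n (isRoot f₀)                               ≡⟨ sym (rootCount≡count f₀) ⟩
      rootCount f₀                                      ∎
      where
      open ℕP.≤-Reasoning
      r₀ = proj₁ (knot-contains-root (proj₁ isMax₀) undomKnot)
      r₀∈K = proj₁ (proj₂ (knot-contains-root (proj₁ isMax₀) undomKnot))
      fr₀ = proj₂ (proj₂ (knot-contains-root (proj₁ isMax₀) undomKnot))
      C′r₀ : E₁.C′ r₀ ≡ true
      C′r₀ = fromVertex-covers (proj₁ (proj₂ undomKnot) j r₀ j∈K r₀∈K)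
      newRoot∖j⊆roots∖r₀ : ∀ x → (newRoot x ∧ not (x ≡ᵇ j)) ≡ true →
        (isRoot f₀ x ∧ not (x ≡ᵇ r₀)) ≡ true
      newRoot∖j⊆roots∖r₀ x e with x ≡ᵇ j | isRoot f₀ x | E₁.C′ x in C′x
      ... | false | true | false with x FinP.≟ r₀
      ...   | yes refl = contradiction (trans (sym C′r₀) C′x) λ ()
      ...   | no  _    = refl

    sameCount : arcCount g ≡ arcCount f₀
    sameCount = ℕP.≤-antisym (proj₂ isMax₀ g (extension-isDivForest E₂)) (rootCount-≤⇒arcCount-≥ f₀ g fewerRoots)

    inTree : ∀ {i} → Reach D j i → InTree g j i
    inTree {i} j↝i = trans (g≡g₁ j (E₁.⊇C j jj)) fromVertex-root , reach
      where
      g≡g₁ : ∀ x → E₁.C′ x ≡ true → g x ≡ E₁.g x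
      g≡g₁ x C′x = E₂.agrees x (∨-trueˡ _ C′x)
      reach : ForestReach g j i
      reach with fromVertex-reach j↝i
      ... | k , e = k , trans (anc-agree (λ y u _ → ForestOn.parent-inside E₁.forestOn y u) g≡g₁ (toℕ k) i
                                         (fromVertex-covers j↝i)) e

  maxForest-with-tree : ∀ {f₀} → IsMax f₀ → ∀ {K} → UndomKnot D K → ∀ {j i} → j ∈ K → Reach D j i →
    ∃[ g ] ((IsDivForest (arc D) g × arcCount g ≡ arcCount f₀) × InTree g j i)
  maxForest-with-tree isMax₀ undomKnot j∈K j↝i = g , (extension-isDivForest E₂ , sameCount) , inTree j↝i
    where open TreeInMaxForest isMax₀ undomKnot j∈K

-- Decomposition along an undominated knot

module KnotDecomposition {n : ℕ} (Γ : Digraph n) (K : Subset n) (undomKnot : UndomKnot Γ K) where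
  open MaxForests Γ

  ΓK Γ₋K : Digraph n
  ΓK  = record { arc = arcK Γ K      ; wt = wt Γ }
  Γ₋K = record { arc = arcMinusK Γ K ; wt = wt Γ }

  |K| : ℕ
  |K| = count n (inK K)

  insideK outsideK : Par n → Par n
  insideK  f x = if inK K x then f x else nothing
  outsideK f x = if inK K x then nothing else f x

  glue : Par n → Par n → Par n
  glue t p x = if inK K x then t x else p x

  glue-split : ∀ f → glue (insideK f) (outsideK f) ≗ f
  glue-split f x with inK K x
  ... | true  = refl
  ... | false = refl

  arcK⇒arc : ∀ {u x} → arcK Γ K u x ≡ true → arc Γ u x ≡ true
  arcK⇒arc = BoolP.∧-conicalˡ _ _

  arcMinusK⇒arc : ∀ {u x} → arcMinusK Γ K u x ≡ true → arc Γ u x ≡ true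
  arcMinusK⇒arc = BoolP.∧-conicalˡ _ _

  inK-predecessor : ∀ {u x} → arc Γ u x ≡ true → inK K x ≡ true → inK K u ≡ true
  inK-predecessor u→x x∈K = dec-true (_ ∈? K) (knot-predecessor undomKnot u→x (dec-true⁻¹ (_ ∈? K) x∈K))

  noArcInto-K : ∀ {u x} → arcMinusK Γ K u x ≡ true → inK K x ≢ true
  noArcInto-K u→x x∈K = contradiction (trans (sym (BoolP.∧-conicalʳ _ _ u→x))
    (cong₂ (λ a b → not (a ∧ b)) (inK-predecessor (arcMinusK⇒arc u→x) x∈K) x∈K)) λ ()

  minusK-root-inside : ∀ {p} → ArcsIn (arcMinusK Γ K) p → ∀ x → inK K x ≡ true → p x ≡ nothing
  minusK-root-inside {p} arcs x x∈K with p x in px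
  ... | nothing = refl
  ... | just u  = contradiction x∈K (noArcInto-K (arcs x u px))

  K-root-outside : ∀ {t} → ArcsIn (arcK Γ K) t → ∀ x → inK K x ≡ false → t x ≡ nothing
  K-root-outside {t} arcs x x∉K with t x in tx
  ... | nothing = refl
  ... | just u  = contradiction (trans (sym x∈K) x∉K) λ ()
    where x∈K = BoolP.∧-conicalʳ (inK K u) _ (BoolP.∧-conicalʳ (arc Γ u x) _ (arcs x u tx))

  glue-arcCount : ∀ {t p} → (∀ x → inK K x ≡ false → t x ≡ nothing) →
    (∀ x → inK K x ≡ true → p x ≡ nothing) → arcCount (glue t p) ≡ arcCount t ℕ.+ arcCount p
  glue-arcCount {t} {p} t-outside p-inside = begin
    arcCount (glue t p)                                ≡⟨ arcCount≡count (glue t p) ⟩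
    count n (is-just ∘ glue t p)                       ≡⟨ count-cong n split ⟩
    count n (λ x → is-just (t x) ∨ is-just (p x))      ≡⟨ count-∨ n _ _ disjoint ⟩
    count n (is-just ∘ t) ℕ.+ count n (is-just ∘ p)    ≡⟨ cong₂ ℕ._+_ (arcCount≡count t) (arcCount≡count p) ⟨
    arcCount t ℕ.+ arcCount p                          ∎
    where
    open ≡-Reasoning
    split : ∀ x → is-just (glue t p x) ≡ (is-just (t x) ∨ is-just (p x))
    split x with inK K x in x∈K
    ... | true  rewrite p-inside x x∈K  = sym (BoolP.∨-identityʳ _)
    ... | false rewrite t-outside x x∈K = refl
    disjoint : ∀ x → is-just (t x) ≡ true → is-just (p x) ≢ true
    disjoint x tx px with inK K x in x∈K
    ... | true  rewrite p-inside x x∈K  = contradiction px λ ()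
    ... | false rewrite t-outside x x∈K = contradiction tx λ ()

  tree-arcCount : ∀ {j t} → j ∈ K → IsTreeFrom Γ K j t → suc (arcCount t) ≡ |K|
  tree-arcCount {j} {t} j∈K ((arcs , _) , spans) = begin
    suc (arcCount t)                            ≡⟨ cong suc (trans (arcCount≡count t) (count-cong n nonRoot≡)) ⟩
    suc (count n (λ x → inK K x ∧ not (x ≡ᵇ j))) ≡⟨ sym (count-remove n (inK K) j (dec-true (j ∈? K) j∈K)) ⟩
    |K|                                         ∎
    where
    open ≡-Reasoning
    nonRoot≡ : ∀ x → is-just (t x) ≡ (inK K x ∧ not (x ≡ᵇ j))
    nonRoot≡ x with inK K x in x∈K | x FinP.≟ j
    ... | false | _        rewrite K-root-outside arcs x x∈K = refl
    ... | true  | yes refl rewrite proj₁ (spans x (dec-true⁻¹ (x ∈? K) x∈K)) = refl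
    ... | true  | no  x≢j with t x in tx
    ...   | just _  = refl
    ...   | nothing with spans x (dec-true⁻¹ (x ∈? K) x∈K)
    ...     | tj , (k , e) = contradiction (root-unique t 0 (toℕ k) tx tj refl e) x≢j

  reach-inside-K : ∀ {a b} → Reach Γ a b → b ∈ K → Reach ΓK a b
  reach-inside-K here           b∈K = here
  reach-inside-K (step {u} {w} a↝u u→w) w∈K = step (reach-inside-K a↝u u∈K) u→ᴷw
    where
    u∈K = knot-predecessor undomKnot u→w w∈K
    u→ᴷw : arcK Γ K u w ≡ true
    u→ᴷw rewrite u→w | dec-true (u ∈? K) u∈K | dec-true (w ∈? K) w∈K = refl

  tree-exists : ∀ {j} → j ∈ K → ∃[ t ] IsTreeFrom Γ K j t
  tree-exists {j} j∈K = g , extension-isDivForest (fromVertex j) , λ x x∈K →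
    fromVertex-root , fromVertex-reach (reach-inside-K (proj₁ (proj₂ undomKnot) j x j∈K x∈K) x∈K)
    where
    open Growth ΓK
    open Extension (fromVertex j)

  isTreeFrom-resp : ∀ j → IsTreeFrom Γ K j Respects _≗_
  isTreeFrom-resp j f≗g (forest , spans) = isDivForest-resp _ f≗g forest , λ x x∈K → inTree-resp j x f≗g (spans x x∈K)

  module Glue {j t p} (j∈K : j ∈ K) (tree : IsTreeFrom Γ K j t) (forest : IsDivForest (arcMinusK Γ K) p) where
    private
      tArcs = proj₁ (proj₁ tree)
      pArcs = proj₁ forest

    t-inside : ParentClosed t (λ x → inK K x ≡ true)
    t-inside x u _ tx = BoolP.∧-conicalˡ _ (inK K x) (BoolP.∧-conicalʳ (arc Γ u x) _ (tArcs x u tx))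

    anc-glue-inside : ∀ k x → inK K x ≡ true → anc (glue t p) k x ≡ anc t k x
    anc-glue-inside = anc-agree t-inside λ x x∈K → cong (λ b → if b then t x else p x) x∈K

    p⊑glue : p ⊑ glue t p
    p⊑glue x with inK K x in x∈K
    ... | true  = inj₁ (minusK-root-inside pArcs x x∈K)
    ... | false = inj₂ refl

    terminates-inside : ∀ x → inK K x ≡ true → Terminates (glue t p) x
    terminates-inside x x∈K with noCircuit⇒terminates t (proj₂ (proj₁ tree)) x
    ... | k , e = k , trans (anc-glue-inside k x x∈K) e

    -- Outside K, glue follows p until p terminates or enters K, where glue follows t.
    terminates-outside : ∀ k x → anc p k x ≡ nothing → Terminates (glue t p) x
    terminates-outside (suc k) x e with inK K x in x∈K
    ... | true  = terminates-inside x x∈K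
    ... | false with p x in px
    ...   | nothing = terminates-root (glue t p) x (trans (cong (λ b → if b then t x else p x) x∈K) px)
    ...   | just u  = terminates-parent (glue t p) x (trans (cong (λ b → if b then t x else p x) x∈K) px)
                        (terminates-outside k u (trans (sym (anc-parent p k x px)) e))

    glue-isDivForest : IsDivForest (arc Γ) (glue t p)
    glue-isDivForest = arcs , terminates⇒noCircuit (glue t p) λ x →
      let k , e = noCircuit⇒terminates p (proj₂ forest) x in terminates-outside k x e
      where
      arcs : ArcsIn (arc Γ) (glue t p)
      arcs x u e with inK K x
      ... | true  = arcK⇒arc (tArcs x u e)
      ... | false = arcMinusK⇒arc (pArcs x u e)

    tree+forest-arcCount : arcCount (glue t p) ≡ arcCount t ℕ.+ arcCount p
    tree+forest-arcCount = glue-arcCount (K-root-outside tArcs) (minusK-root-inside pArcs)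

    glue-inTree : ∀ {i} → ∃[ z ] (z ∈ K × ForestReach p z i) → InTree (glue t p) j i
    glue-inTree {i} (z , z∈K , (k , e)) = glue-j , (l , trans e₃ (cong just r≡j))
      where
      glue-j : glue t p j ≡ nothing
      glue-j rewrite dec-true (j ∈? K) j∈K = proj₁ (proj₂ tree j j∈K)
      z↝j = proj₂ (proj₂ tree z z∈K)
      m = toℕ (proj₁ z↝j)
      long : anc (glue t p) (m ℕ.+ toℕ k) i ≡ just j
      long = trans (anc-+ (glue t p) i m (anc-⊑ p⊑glue (toℕ k) i e))
                   (trans (anc-glue-inside m z (dec-true (z ∈? K) z∈K)) (proj₂ z↝j))
      root = root-of (glue t p) (proj₂ glue-isDivForest) i
      r = proj₁ root
      l = proj₁ (proj₂ (proj₂ root))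
      e₃ = proj₂ (proj₂ (proj₂ root))
      r≡j : r ≡ j
      r≡j = root-unique (glue t p) (toℕ l) (m ℕ.+ toℕ k) (proj₁ (proj₂ root)) glue-j e₃ long

  insideK⊑ : ∀ f → insideK f ⊑ f
  insideK⊑ f x with inK K x
  ... | true  = inj₂ refl
  ... | false = inj₁ refl

  outsideK⊑ : ∀ f → outsideK f ⊑ f
  outsideK⊑ f x with inK K x
  ... | true  = inj₁ refl
  ... | false = inj₂ refl

  outsideK-isDivForest : ∀ {f} → IsDivForest (arc Γ) f → IsDivForest (arcMinusK Γ K) (outsideK f)
  outsideK-isDivForest {f} (arcs , noCircuit) = arcs⁻ , noCircuit-⊑ (outsideK⊑ f) noCircuit
    where
    arcs⁻ : ArcsIn (arcMinusK Γ K) (outsideK f)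
    arcs⁻ x u e with inK K x in x∈K
    ... | false rewrite arcs x u e | BoolP.∧-zeroʳ (inK K u) = refl

  outsideK-reach : ∀ {f j} → j ∈ K → ∀ k i → anc f k i ≡ just j →
    ∃[ z ] (z ∈ K × ∃[ l ] (l ≤ k × anc (outsideK f) l i ≡ just z))
  outsideK-reach {j = j} j∈K zero i e = j , j∈K , 0 , z≤n , e
  outsideK-reach {f} j∈K (suc k) i e with inK K i in i∈K
  ... | true  = i , dec-true⁻¹ (i ∈? K) i∈K , 0 , z≤n , refl
  ... | false with f i in fi
  ...   | nothing = contradiction (trans (sym e) (anc-root f k i fi)) λ ()
  ...   | just q with outsideK-reach j∈K k q (trans (sym (anc-parent f k i fi)) e)
  ...     | z , z∈K , l , l≤k , e′ = z , z∈K , suc l , s≤s l≤k , trans (anc-parent (outsideK f) l i outsideK-i) e′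
    where
    outsideK-i : outsideK f i ≡ just q
    outsideK-i = trans (cong (λ b → if b then nothing else f i) i∈K) fi

  outsideK-forestReach : ∀ {f j i} → j ∈ K → ForestReach f j i → ∃[ z ] (z ∈ K × ForestReach (outsideK f) z i)
  outsideK-forestReach {f} {j} {i} j∈K (k , e) with outsideK-reach j∈K (toℕ k) i e
  ... | z , z∈K , l , l≤k , e′ =
    z , z∈K , fromℕ< l<n , trans (cong (λ m → anc (outsideK f) m i) (FinP.toℕ-fromℕ< l<n)) e′
    where l<n = ℕP.≤-<-trans l≤k (FinP.toℕ<n k)

  insideK-isTree : ∀ {f j} → IsMax f → f j ≡ nothing → j ∈ K → IsTreeFrom Γ K j (insideK f)
  insideK-isTree {f} {j} isMax@((arcs , noCircuit) , _) fj j∈K =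
    (arcsᴷ , noCircuit-⊑ (insideK⊑ f) noCircuit) , spans
    where
    arcsᴷ : ArcsIn (arcK Γ K) (insideK f)
    arcsᴷ x u e with inK K x in x∈K
    ... | true rewrite arcs x u e | inK-predecessor (arcs x u e) x∈K = refl
    closed : ParentClosed f (_∈ K)
    closed = knot-parentClosed arcs undomKnot
    spans : ∀ x → x ∈ K → InTree (insideK f) j x
    spans x x∈K with root-of f noCircuit x
    ... | r , fr , (k , e) = insideK-j , k , trans (anc-agree closed agrees (toℕ k) x x∈K) (trans e (cong just r≡j))
      where
      agrees : ∀ y → y ∈ K → insideK f y ≡ f y
      agrees y y∈K rewrite dec-true (y ∈? K) y∈K = refl
      insideK-j : insideK f j ≡ nothing
      insideK-j = trans (agrees j j∈K) fj
      r≡j : r ≡ j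
      r≡j = knot-root-unique isMax undomKnot (anc-closed closed (toℕ k) x x∈K e) j∈K fr fj

  split-arcCount : ∀ f → arcCount f ≡ arcCount (insideK f) ℕ.+ arcCount (outsideK f)
  split-arcCount f = trans (arcCount-resp (λ x → sym (glue-split f x))) (glue-arcCount inside outside)
    where
    inside : ∀ x → inK K x ≡ false → insideK f x ≡ nothing
    inside x x∉K rewrite x∉K = refl
    outside : ∀ x → inK K x ≡ true → outsideK f x ≡ nothing
    outside x x∈K rewrite x∈K = refl

  wF-glue : ∀ (Δ : Digraph n) {t p} → (∀ x → inK K x ≡ false → t x ≡ nothing) →
    (∀ x → inK K x ≡ true → p x ≡ nothing) → wF Δ (glue t p) ≡ wF Δ t * wF Δ p
  wF-glue Δ {t} {p} t-outside p-inside =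
    trans (prodL-cong (List.allFin n) split) (prodL-* (List.allFin n) (weight t) (weight p))
    where
    weight : Par n → Fin n → ℚ
    weight f v = maybe (λ u → wt Δ u v) 1ℚ (f v)
    split : ∀ v → weight (glue t p) v ≡ weight t v * weight p v
    split v with inK K v in v∈K
    ... | true  rewrite p-inside v v∈K  = sym (ℚP.*-identityʳ _)
    ... | false rewrite t-outside v v∈K = sym (ℚP.*-identityˡ _)

  reach₋K-into-K : ∀ {r w} → Reach Γ₋K r w → inK K w ≡ true → r ≡ w
  reach₋K-into-K here             _   = refl
  reach₋K-into-K (step _ u→w) w∈K = contradiction w∈K (noArcInto-K u→w)

  undomKnot-lift : ∀ {K′} → UndomKnot Γ₋K K′ → (∀ w → w ∈ K′ → inK K w ≡ false) → UndomKnot Γ K′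
  undomKnot-lift {K′} (nonempty , mutualReach , noArcIn) disjoint =
    nonempty , (λ a b a∈ b∈ → reach-mono (λ _ _ → arcMinusK⇒arc) (mutualReach a b a∈ b∈)) , noArcInΓ
    where
    noArcInΓ : ∀ u w → u ∉ K′ → w ∈ K′ → arc Γ u w ≡ false
    noArcInΓ u w u∉ w∈ with arc Γ u w in u→w
    ... | false = refl
    ... | true  = contradiction (noArcIn u w u∉ w∈) (λ e → contradiction (trans (sym e) minus) λ ())
      where
      minus : arcMinusK Γ K u w ≡ true
      minus rewrite u→w | disjoint w w∈ | BoolP.∧-zeroʳ (inK K u) = refl

  ≗glue⇔ : ∀ {f t p} → ArcsIn (arcK Γ K) t → ArcsIn (arcMinusK Γ K) p →
    f ≗ glue t p ⇔ (t ≗ insideK f × p ≗ outsideK f)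
  ≗glue⇔ {f} {t} {p} tArcs pArcs = mk⇔ to from
    where
    to : f ≗ glue t p → t ≗ insideK f × p ≗ outsideK f
    to f≗ = t≗ , p≗
      where
      t≗ : t ≗ insideK f
      t≗ x with inK K x in x∈K
      ... | true  = sym (trans (f≗ x) (cong (λ b → if b then t x else p x) x∈K))
      ... | false = K-root-outside tArcs x x∈K
      p≗ : p ≗ outsideK f
      p≗ x with inK K x in x∈K
      ... | true  = minusK-root-inside pArcs x x∈K
      ... | false = sym (trans (f≗ x) (cong (λ b → if b then t x else p x) x∈K))
    from : t ≗ insideK f × p ≗ outsideK f → f ≗ glue t p
    from (t≗ , p≗) x with inK K x in x∈K
    ... | true  = sym (trans (t≗ x) (cong (λ b → if b then f x else nothing) x∈K))
    ... | false = sym (trans (p≗ x) (cong (λ b → if b then nothing else f x) x∈K))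

-- The matrix of maximum out forests

wF-pos : ∀ {n} (Γ : Digraph n) → WeightedDigraph Γ → ∀ {f} → ArcsIn (arc Γ) f → 0ℚ ℚ.< wF Γ f
wF-pos {n} Γ (_ , positive) {f} arcs = prodL-pos (List.allFin n) arcWeight-pos
  where
  arcWeight-pos : ∀ v → 0ℚ ℚ.< maybe (λ u → wt Γ u v) 1ℚ (f v)
  arcWeight-pos v with f v in fv
  ... | nothing = ℚP.positive⁻¹ 1ℚ
  ... | just u  = positive u v (arcs v u fv)

module _ {n : ℕ} where

  ForestOfSize : (Fin n → Fin n → Bool) → ℕ → Par n → Set
  ForestOfSize A k f = IsDivForest A f × arcCount f ≡ k

  forestOfSize? : ∀ A k f → Dec (ForestOfSize A k f)
  forestOfSize? A k f = isDivForest? A f ×-dec (arcCount f ℕP.≟ k)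

  forestOfSize-resp : ∀ A k → ForestOfSize A k Respects _≗_
  forestOfSize-resp A k f≗g (forest , size) = isDivForest-resp A f≗g forest , trans (sym (arcCount-resp f≗g)) size

module MaxForestMatrix {n : ℕ} (Γ : Digraph n) (weighted : WeightedDigraph Γ)
                       {N f₀} (isMax₀ : IsMaxOutForest (arc Γ) f₀) (f₀-size : arcCount f₀ ≡ N) where
  open MaxForests Γ

  isMax-ofSize : ∀ {f} → ForestOfSize (arc Γ) N f → IsMax f
  isMax-ofSize (forest , size) = isMax-sameCount isMax₀ forest (trans size (sym f₀-size))

  row-sum : ∀ i → sumFin (λ j → qEntry Γ N i j) ≡ epsF Γ N
  row-sum i = sumWhere-fibres (forestOfSize? (arc Γ) N) (λ f j → does (inTree? f j i)) (wF Γ) uniqueRoot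
    where
    uniqueRoot : ∀ f → ForestOfSize (arc Γ) N f →
      ∃[ r ] (does (inTree? f r i) ≡ true × ∀ j → does (inTree? f j i) ≡ true → j ≡ r)
    uniqueRoot f ((_ , noCircuit) , _) with root-of f noCircuit i
    ... | r , fr , (k , e) = r , dec-true (inTree? f r i) (fr , k , e) , λ j j-root →
      let fj , (l , e′) = dec-true⁻¹ (inTree? f j i) j-root in root-unique f (toℕ l) (toℕ k) fj fr e′ e

  q≢0⇔ : ∀ i j → qEntry Γ N i j ≢ 0ℚ ⇔ (InKtilde Γ j × Reach Γ j i)
  q≢0⇔ i j = mk⇔ nonzero⇒ ⇒nonzero
    where
    P? = λ f → forestOfSize? (arc Γ) N f ×-dec inTree? f j i
    nonzero⇒ : qEntry Γ N i j ≢ 0ℚ → InKtilde Γ j × Reach Γ j i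
    nonzero⇒ q≢0 with sumL-witness P? (wF Γ) (allPar n) q≢0
    ... | f , (forest , fj , j↝i) =
      (knotOf j , knotOf-root (isMax-ofSize forest) fj) , forestReach⇒reach Γ (proj₁ (proj₁ forest)) j↝i
    ⇒nonzero : InKtilde Γ j × Reach Γ j i → qEntry Γ N i j ≢ 0ℚ
    ⇒nonzero ((K , undomKnot , j∈K) , j↝i) = ℚP.<⇒≢ (sumWhere-pos P? (wF Γ) P-resp (wF-resp Γ)
      (λ f ((forest , _) , _) → wF-pos Γ weighted (proj₁ forest)) witness) ∘ sym
      where
      P-resp : (λ f → ForestOfSize (arc Γ) N f × InTree f j i) Respects _≗_
      P-resp f≗g (forest , inTree) = forestOfSize-resp (arc Γ) N f≗g forest , inTree-resp j i f≗g inTree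
      witness = let g , (forest , size) , inTree = maxForest-with-tree isMax₀ undomKnot j∈K j↝i
                in g , (forest , trans size f₀-size) , inTree

  undominated-diagonal : ∀ j → Undominated Γ j → qEntry Γ N j j ≡ epsF Γ N
  undominated-diagonal j undominated =
    sumWhere-cong (λ f → forestOfSize? (arc Γ) N f ×-dec inTree? f j j) (forestOfSize? (arc Γ) N) (wF Γ) λ f →
      mk⇔ proj₁ λ forest → forest , root forest , forestReach-refl f j
    where
    root : ∀ {f} → ForestOfSize (arc Γ) N f → f j ≡ nothing
    root {f} ((arcs , _) , _) with f j in fj
    ... | nothing = refl
    ... | just u  = contradiction (trans (sym (arcs j u fj)) (undominated u)) λ ()

  module AlongKnot {K} (undomKnot : UndomKnot Γ K)
                   {m p₀} (isMax₋ : IsMaxOutForest (arcMinusK Γ K) p₀) (p₀-size : arcCount p₀ ≡ m) where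
    open KnotDecomposition Γ K undomKnot

    -- Splitting f₀ at its root in K, and gluing a spanning tree of Γ_K to p₀, give the two inequalities.
    |K|+m≡1+N : |K| ℕ.+ m ≡ suc N
    |K|+m≡1+N = ℕP.≤-antisym glued≤ split≤
      where
      open ℕP.≤-Reasoning
      r₀ = proj₁ (knot-contains-root (proj₁ isMax₀) undomKnot)
      r₀∈K = proj₁ (proj₂ (knot-contains-root (proj₁ isMax₀) undomKnot))
      f₀r₀ = proj₂ (proj₂ (knot-contains-root (proj₁ isMax₀) undomKnot))
      t₀ = proj₁ (tree-exists r₀∈K)
      t₀-tree = proj₂ (tree-exists r₀∈K)
      module G₀ = Glue r₀∈K t₀-tree (proj₁ isMax₋)
      glued≤ : |K| ℕ.+ m ≤ suc N
      glued≤ = begin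
        |K| ℕ.+ m                        ≡⟨ cong₂ ℕ._+_ (sym (tree-arcCount r₀∈K t₀-tree)) (sym p₀-size) ⟩
        suc (arcCount t₀ ℕ.+ arcCount p₀) ≡⟨ cong suc (sym G₀.tree+forest-arcCount) ⟩
        suc (arcCount (glue t₀ p₀))      ≤⟨ ℕ.s≤s (proj₂ isMax₀ _ G₀.glue-isDivForest) ⟩
        suc (arcCount f₀)                ≡⟨ cong suc f₀-size ⟩
        suc N                            ∎
      split≤ : suc N ≤ |K| ℕ.+ m
      split≤ = begin
        suc N
          ≡⟨ cong suc (trans (sym f₀-size) (split-arcCount f₀)) ⟩
        suc (arcCount (insideK f₀)) ℕ.+ arcCount (outsideK f₀)
          ≡⟨ cong (ℕ._+ arcCount (outsideK f₀)) (tree-arcCount r₀∈K (insideK-isTree isMax₀ f₀r₀ r₀∈K)) ⟩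
        |K| ℕ.+ arcCount (outsideK f₀)
          ≤⟨ ℕP.+-monoʳ-≤ |K| (ℕP.≤-trans (proj₂ isMax₋ _ (outsideK-isDivForest (proj₁ isMax₀))) (ℕP.≤-reflexive p₀-size)) ⟩
        |K| ℕ.+ m ∎

    ReachedFromK : Par n → Fin n → Set
    ReachedFromK p i = ∃[ z ] (z ∈ K × ForestReach p z i)

    reachedFromK? : ∀ p i → Dec (ReachedFromK p i)
    reachedFromK? p i = FinP.any? λ z → (z ∈? K) ×-dec forestReach? p z i

    module _ {j} (j∈K : j ∈ K) where

      split-sizes : ∀ {t p : Par n} → IsTreeFrom Γ K j t → arcCount t ℕ.+ arcCount p ≡ N → arcCount p ≡ m
      split-sizes {t} {p} tree size = ℕP.+-cancelˡ-≡ |K| _ _ (begin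
        |K| ℕ.+ arcCount p                 ≡⟨ cong (ℕ._+ arcCount p) (sym (tree-arcCount j∈K tree)) ⟩
        suc (arcCount t ℕ.+ arcCount p)    ≡⟨ cong suc size ⟩
        suc N                              ≡⟨ sym |K|+m≡1+N ⟩
        |K| ℕ.+ m                          ∎)
        where open ≡-Reasoning

      glue-sizes : ∀ {t p : Par n} → IsTreeFrom Γ K j t → arcCount p ≡ m → arcCount t ℕ.+ arcCount p ≡ N
      glue-sizes {t} {p} tree size = ℕP.suc-injective (begin
        suc (arcCount t ℕ.+ arcCount p)    ≡⟨ cong₂ ℕ._+_ (tree-arcCount j∈K tree) size ⟩
        |K| ℕ.+ m                          ≡⟨ |K|+m≡1+N ⟩
        suc N                              ∎)
        where open ≡-Reasoning

      module _ (i : Fin n) where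

        InForest InRest : Par n → Set
        InForest f = ForestOfSize (arc Γ) N f × InTree f j i
        InRest p   = ForestOfSize (arcMinusK Γ K) m p × ReachedFromK p i

        rest-resp : InRest Respects _≗_
        rest-resp f≗g (forest , z , z∈K , reach) =
          forestOfSize-resp _ m f≗g forest , z , z∈K , forestReach-resp z i f≗g reach

        forest⇔tree×rest : ∀ f → InForest f ⇔ (IsTreeFrom Γ K j (insideK f) × InRest (outsideK f))
        forest⇔tree×rest f = mk⇔ split join
          where
          split : InForest f → IsTreeFrom Γ K j (insideK f) × InRest (outsideK f)
          split (forest , fj , j↝i) = tree , (outsideK-isDivForest (proj₁ forest) ,
              split-sizes {p = outsideK f} tree (trans (sym (split-arcCount f)) (proj₂ forest))) , outsideK-forestReach j∈K j↝i
            where tree = insideK-isTree (isMax-ofSize forest) fj j∈K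
          join : IsTreeFrom Γ K j (insideK f) × InRest (outsideK f) → InForest f
          join (tree , (forest , size) , reached) =
            ( (isDivForest-resp _ (glue-split f) Gl.glue-isDivForest
              , trans (arcCount-resp (sym ∘ glue-split f))
                      (trans Gl.tree+forest-arcCount (glue-sizes {p = outsideK f} tree size)))
            , inTree-resp j i (glue-split f) (Gl.glue-inTree reached))
            where module Gl = Glue j∈K tree forest

    q≡εT*εPto : ∀ {j} → j ∈ K → ∀ i → qEntry Γ N i j ≡ epsT Γ K j * epsPto Γ K m i
    q≡εT*εPto {j} j∈K i = sumWhere-product
      (λ f → forestOfSize? (arc Γ) N f ×-dec inTree? f j i) (isTreeFrom? Γ K j)
      (λ p → forestOfSize? (arcMinusK Γ K) m p ×-dec reachedFromK? p i)
      (isTreeFrom-resp j) (rest-resp j∈K i) glue insideK outsideK (forest⇔tree×rest j∈K i)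
      (λ f t p ((tArcs , _) , _) (((pArcs , _) , _) , _) → ≗glue⇔ tArcs pArcs)
      (wF Γ) (wF-resp Γ)
      λ t p ((tArcs , _) , _) (((pArcs , _) , _) , _) → wF-glue Γ (K-root-outside tArcs) (minusK-root-inside pArcs)

    εPto≡εP : ∀ i → (∀ p → ForestOfSize (arcMinusK Γ K) m p → ReachedFromK p i) → epsPto Γ K m i ≡ epsP Γ K m
    εPto≡εP i reached = sumWhere-cong
      (λ p → forestOfSize? (arcMinusK Γ K) m p ×-dec reachedFromK? p i) (forestOfSize? (arcMinusK Γ K) m) (wF Γ)
      λ p → mk⇔ proj₁ λ forest → forest , reached p forest

    -- A root of a maximum forest of Γ₋K outside K lies in an undominated knot of Γ other than K.
    Kplus-reached : ∀ i → InKplus Γ K i → ∀ p → ForestOfSize (arcMinusK Γ K) m p → ReachedFromK p i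
    Kplus-reached i (_ , unreachable) p (forest , size) with root-of p (proj₂ forest) i
    ... | r , pr , r↝i with r ∈? K
    ...   | yes r∈K = r , r∈K , r↝i
    ...   | no  r∉K = contradiction (reach-mono (λ _ _ → arcMinusK⇒arc) (forestReach⇒reach Γ₋K (proj₁ forest) r↝i))
                        (unreachable K′ (undomKnot-lift knot disjoint) (r∉K ∘ λ K′≡K → subst (r ∈_) K′≡K r∈K′) r r∈K′)
      where
      module M₋ = MaxForests Γ₋K
      K′ = M₋.knotOf r
      knot = proj₁ (M₋.knotOf-root (M₋.isMax-sameCount isMax₋ forest (trans size (sym p₀-size))) pr)
      r∈K′ = proj₂ (M₋.knotOf-root (M₋.isMax-sameCount isMax₋ forest (trans size (sym p₀-size))) pr)
      disjoint : ∀ w → w ∈ K′ → inK K w ≡ false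
      disjoint w w∈K′ with inK K w in w∈K
      ... | false = refl
      ... | true  = contradiction (subst (_∈ K) (sym (reach₋K-into-K (proj₂ (M₋.∈-knotOf⁻¹ w∈K′)) w∈K))
                                         (dec-true⁻¹ (w ∈? K) w∈K)) r∉K

    εT-pos : ∀ {j} → j ∈ K → 0ℚ ℚ.< epsT Γ K j
    εT-pos {j} j∈K = sumWhere-pos (isTreeFrom? Γ K j) (wF Γ) (isTreeFrom-resp j) (wF-resp Γ)
      (λ t ((arcs , _) , _) → wF-pos Γ weighted (λ x u tx → arcK⇒arc (arcs x u tx))) (tree-exists j∈K)

    knot-diagonal-sum : sumFin (λ j → if does (j ∈? K) then qEntry Γ N j j else 0ℚ) ≡ epsF Γ N
    knot-diagonal-sum = trans
      (sumL-cong (List.allFin n) λ j → trans (ind-sumL (allPar n) (inK K j) (λ f → ind (F f ∧ c f j) (wF Γ f)))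
                                             (sumL-cong (allPar n) λ f → ind-ind-∧ (inK K j) (F f) (c f j) (wF Γ f)))
                        (sumWhere-fibres (forestOfSize? (arc Γ) N) (λ f j → inK K j ∧ does (inTree? f j j)) (wF Γ) uniqueRoot)
      where
      F : Par n → Bool
      F f = does (forestOfSize? (arc Γ) N f)
      c : Par n → Fin n → Bool
      c f j = does (inTree? f j j)
      uniqueRoot : ∀ f → ForestOfSize (arc Γ) N f →
        ∃[ r ] ((inK K r ∧ does (inTree? f r r)) ≡ true × ∀ j → (inK K j ∧ does (inTree? f j j)) ≡ true → j ≡ r)
      uniqueRoot f forest with knot-contains-root (proj₁ forest) undomKnot
      ... | r , r∈K , fr = r , cong₂ _∧_ (dec-true (r ∈? K) r∈K) (dec-true (inTree? f r r) (fr , forestReach-refl f r)) ,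
        λ j e → knot-root-unique (isMax-ofSize forest) undomKnot (dec-true⁻¹ (j ∈? K) (BoolP.∧-conicalˡ _ _ e)) r∈K
                  (proj₁ (dec-true⁻¹ (inTree? f j j) (BoolP.∧-conicalʳ (inK K j) _ e))) fr

    knot-column : ∀ j → j ∈ K →
      (∀ i → qEntry Γ N i j ≡ epsT Γ K j * epsPto Γ K m i) ×
      (∀ i → InKplus Γ K i → (qEntry Γ N i j ≡ qEntry Γ N j j) × (qEntry Γ N j j ≡ epsT Γ K j * epsP Γ K m))
    knot-column j j∈K = q≡εT*εPto j∈K , λ i i∈K⁺ →
      (begin
        qEntry Γ N i j             ≡⟨ q≡εT*εPto j∈K i ⟩
        epsT Γ K j * epsPto Γ K m i ≡⟨ cong (epsT Γ K j *_) (trans (εPto≡εP i (Kplus-reached i i∈K⁺)) (sym εPto≡εP-j)) ⟩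
        epsT Γ K j * epsPto Γ K m j ≡⟨ sym (q≡εT*εPto j∈K j) ⟩
        qEntry Γ N j j             ∎) ,
      trans (q≡εT*εPto j∈K j) (cong (epsT Γ K j *_) εPto≡εP-j)
      where
      open ≡-Reasoning
      εPto≡εP-j : epsPto Γ K m j ≡ epsP Γ K m
      εPto≡εP-j = εPto≡εP j λ p _ → j , j∈K , forestReach-refl p j

    column-ratio : ∀ j₁ j₂ → j₁ ∈ K → j₂ ∈ K →
      Σ (NonZero (epsT Γ K j₁)) λ nz →
        ∀ i → qEntry Γ N i j₂ ≡ (epsT Γ K j₂ ÷ epsT Γ K j₁) {{nz}} * qEntry Γ N i j₁
    column-ratio j₁ j₂ j₁∈K j₂∈K = nz , λ i → begin
      qEntry Γ N i j₂                       ≡⟨ q≡εT*εPto j₂∈K i ⟩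
      epsT Γ K j₂ * epsPto Γ K m i          ≡⟨ *-÷-cancel (epsT Γ K j₂) (epsT Γ K j₁) (epsPto Γ K m i) {{nz}} ⟩
      ratio * (epsT Γ K j₁ * epsPto Γ K m i) ≡⟨ cong (ratio *_) (q≡εT*εPto j₁∈K i) ⟨
      ratio * qEntry Γ N i j₁               ∎
      where
      open ≡-Reasoning
      nz : NonZero (epsT Γ K j₁)
      nz = ℚP.pos⇒nonZero (epsT Γ K j₁) {{ℚ.positive (εT-pos j₁∈K)}}
      ratio = (epsT Γ K j₂ ÷ epsT Γ K j₁) {{nz}}

theorem2 : (n : ℕ) → 2 ≤ n → (Γ : Digraph n) → WeightedDigraph Γ →
    (v : ℕ) → ForestDim Γ v →
    (K : Subset n) → UndomKnot Γ K →
    (m : ℕ) → MaxForestArcs (arcMinusK Γ K) m →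
    -- 1.
    (∀ (i : Fin n) → sumFin (λ j → qEntry Γ (n ∸ v) i j) ≡ epsF Γ (n ∸ v)) ×
    -- 2.
    (∀ (i j : Fin n) →
       (qEntry Γ (n ∸ v) i j ≢ 0ℚ) ⇔ (InKtilde Γ j × Reach Γ j i)) ×
    -- 3.
    (∀ (j : Fin n) → j ∈ K →
       (∀ (i : Fin n) → qEntry Γ (n ∸ v) i j ≡ epsT Γ K j * epsPto Γ K m i) ×
       (∀ (i : Fin n) → InKplus Γ K i →
          (qEntry Γ (n ∸ v) i j ≡ qEntry Γ (n ∸ v) j j) ×
          (qEntry Γ (n ∸ v) j j ≡ epsT Γ K j * epsP Γ K m))) ×
    -- 4.
    (sumFin (λ j → if does (j ∈? K) then qEntry Γ (n ∸ v) j j else 0ℚ)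
       ≡ epsF Γ (n ∸ v)) ×
    (∀ (j : Fin n) → Undominated Γ j → qEntry Γ (n ∸ v) j j ≡ epsF Γ (n ∸ v)) ×
    -- 5.
    (∀ (j₁ j₂ : Fin n) → j₁ ∈ K → j₂ ∈ K →
       Σ (NonZero (epsT Γ K j₁)) λ nz →
         ∀ (i : Fin n) →
           qEntry Γ (n ∸ v) i j₂ ≡ (epsT Γ K j₂ ÷ epsT Γ K j₁) {{nz}} * qEntry Γ (n ∸ v) i j₁)
theorem2 n _ Γ weighted v (f₀ , isMax₀ , f₀-roots) K undomKnot m (p₀ , isMax₋ , p₀-size) =
  row-sum , q≢0⇔ , knot-column , knot-diagonal-sum , undominated-diagonal , column-ratio
  where
  f₀-size : arcCount f₀ ≡ n ∸ v
  f₀-size = trans (arcCount≡n∸rootCount f₀) (cong (n ∸_) f₀-roots)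
  open MaxForestMatrix Γ weighted isMax₀ f₀-size
  open AlongKnot undomKnot isMax₋ p₀-size
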